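{- Let $a>1$ be an integer and let $(n_1,\dots,n_t)$ and $(m_1,\dots,m_s)$ be tuples of positive integers such that $$\prod_{i=1}^t (a^{n_i}-1)=\prod_{j=1}^s (a^{m_j}-1).$$ Then: if $a=2$, the multisets $\{n_i : n_i\nmid 6\}$ and $\{m_j : m_j\nmid 6\}$ are equal; if $a=3$, the multisets $\{n_i : n_i\nmid 2\}$ and $\{m_j : m_j\nmid 2\}$ are equal; if $a\neq 2,3$, the multisets $\{n_1,\dots,n_t\}$ and $\{m_1,\dots,m_s\}$ are equal.
   Context: A multiset is a collection of not necessarily distinct objects; two multisets are equal if each object occurs in both with the same multiplicity. -}

module Defs where

open import Data.Nat using (ℕ; _^_; _∸_)
open import Data.Nat.Divisibility using (_∣?_)
open import Data.Nat.ListAction using (product)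
open import Data.List using (List; map; filter)
open import Relation.Nullary.Decidable using (¬?)
open import Relation.Binary.PropositionalEquality using (_≡_)

-- ∏_i (a^{n_i} - 1) = ∏_j (a^{m_j} - 1)   (truncated subtraction is exact since a^n ≥ 1 for a ≥ 1)
prodCyc : ℕ → List ℕ → List ℕ → Set
prodCyc a ns ms = product (map (λ n → a ^ n ∸ 1) ns) ≡ product (map (λ m → a ^ m ∸ 1) ms)

-- the sub-multiset { n_i : n_i ∤ d } (as a sublist, order preserved)
nondivisors : ℕ → List ℕ → List ℕ
nondivisors d ns = filter (λ n → ¬? (n ∣? d)) ns

module Submission where

-- Idea: cancel the largest exponent N occurring on either side.  A primitive prime divisor p of
-- a ^ N - 1 (one dividing no a ^ k - 1 with 0 < k < N) divides some factor a ^ m - 1 of the other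
-- side; then N ∣ m and maximality forces m = N.  Primitive divisors exist by Zsigmondy's theorem
-- for all N ≥ 3 except (a, N) = (2, 6); N = 1 is immediate, and N = 2 needs a separate argument
-- when a + 1 is a power of 2.

open import Defs

open import Data.Nat
open import Data.Nat.Properties
open import Data.Nat.Divisibility
open import Data.Nat.DivMod
open import Data.Nat.Primality
open import Data.Nat.Primality.Factorisation using (factorise; PrimeFactorisation; factorisationHasAllPrimeFactors)
open import Data.Nat.Coprimality using (coprime-divisor)
open import Data.Nat.Induction using (<-rec)
open import Data.Nat.ListAction using (product)
open import Data.Nat.ListAction.Properties using (product-++; ∈⇒∣product)
open import Data.Nat.Tactic.RingSolver using (solve-∀)
open import Algebra.Properties.CommutativeSemigroup *-commutativeSemigroup using (x∙yz≈y∙xz)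
open import Data.Bool using (Bool; true; false; not)
open import Data.Bool.Properties using (not-involutive)
open import Data.Empty using (⊥; ⊥-elim)
open import Data.Product using (Σ; _×_; _,_; proj₁; proj₂)
open import Data.Sum using (_⊎_; inj₁; inj₂)
open import Data.List using (List; []; _∷_; _++_; length; map; filter; downFrom)
open import Data.List.Properties
  using (≡-dec; length-++-sucʳ; map-++; filter-++; filter-accept; filter-reject; filter-all; filter-none; filter-some;
         ++-conicalˡ; ++-conicalʳ)
open import Data.List.Extrema.Nat using (max; ⊥≤max; xs≤max; argmax-sel)
open import Data.List.Relation.Unary.All as All using (All; []; _∷_)
open import Data.List.Relation.Unary.All.Properties using (++⁺; ++⁻; ¬All⇒Any¬)
open import Data.List.Relation.Unary.Any as Any using (here; there)
open import Data.List.Relation.Unary.AllPairs as AllPairs using (AllPairs; []; _∷_)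
open import Data.List.Relation.Unary.AllPairs.Properties as AllPairsₚ using (applyDownFrom⁺₁)
open import Data.List.Relation.Unary.Unique.Propositional using (Unique)
open import Data.List.Membership.Propositional using (_∈_; find; lose)
open import Data.List.Membership.Propositional.Properties
  using (∈-∃++; ∈-++⁻; ∈-filter⁺; ∈-filter⁻; ∈-map⁺; ∈-map⁻; ∈-downFrom⁺)
open import Data.List.Relation.Binary.Permutation.Propositional using (_↭_; ↭-sym; ↭-trans; ↭-prep; ↭-reflexive)
open import Data.List.Relation.Binary.Permutation.Propositional.Properties using (shift)
open import Relation.Nullary using (¬_; Dec; yes; no)
open import Relation.Nullary.Decidable using (¬?; _×-dec_; _⊎-dec_; _→-dec_; map′; from-yes; decidable-stable)
open import Relation.Binary.PropositionalEquality

prime>1 : ∀ {p} → Prime p → 1 < p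
prime>1 {2+ _} _ = s≤s (s≤s z≤n)

quotient-pos : ∀ {x q p} → 0 < x → x ≡ q * p → 0 < q
quotient-pos {q = zero} x>0 refl = x>0
quotient-pos {q = suc q} _ _ = s≤s z≤n

primeFactor : ∀ x → 1 < x → Σ ℕ λ p → Prime p × p ∣ x
primeFactor x x>1 = firstFactor (factors f) (isFactorisation f) (factorsPrime f)
  where
  instance _ = >-nonZero (<-trans (s≤s z≤n) x>1)
  f = factorise x
  open PrimeFactorisation
  firstFactor : (fs : List ℕ) → x ≡ product fs → All Prime fs → Σ ℕ λ p → Prime p × p ∣ x
  firstFactor [] e _ = ⊥-elim (<⇒≢ x>1 (sym e))
  firstFactor (q ∷ fs) e (pq ∷ _) = q , pq , divides (product fs) (trans e (*-comm q (product fs)))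

record PPart (p x : ℕ) : Set where
  field
    exponent : ℕ
    cofactor : ℕ
    splits   : x ≡ p ^ exponent * cofactor
    coprime  : ¬ (p ∣ cofactor)

pPart : ∀ {p} → 1 < p → ∀ x → 0 < x → PPart p x
pPart {p} p>1 = <-rec (λ x → 0 < x → PPart p x) step
  where
  step : ∀ x → (∀ {y} → y < x → 0 < y → PPart p y) → 0 < x → PPart p x
  step x rec x>0 with p ∣? x
  ... | no p∤x = record { exponent = 0 ; cofactor = x ; splits = sym (+-identityʳ x) ; coprime = p∤x }
  ... | yes (divides q x≡q*p) = record { exponent = suc k ; cofactor = m ; splits = x-split ; coprime = p∤m }
    where
    q>0 = quotient-pos x>0 x≡q*p
    q<x : q < x
    q<x = subst (q <_) (sym x≡q*p) (m<m*n q p p>1)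
      where instance _ = >-nonZero q>0
    open PPart (rec q<x q>0) renaming (exponent to k; cofactor to m; splits to q-split; coprime to p∤m)
    x-split : x ≡ p ^ suc k * m
    x-split = begin
      x               ≡⟨ x≡q*p ⟩
      q * p           ≡⟨ cong (_* p) q-split ⟩
      p ^ k * m * p   ≡⟨ *-comm (p ^ k * m) p ⟩
      p * (p ^ k * m) ≡⟨ *-assoc p (p ^ k) m ⟨
      p ^ suc k * m   ∎
      where open ≡-Reasoning

-- The p-adic valuation of x (with the convention val p 0 = 0).
val : (p : ℕ) → 1 < p → ℕ → ℕ
val p p>1 zero = 0
val p p>1 x@(suc _) = PPart.exponent (pPart p>1 x (s≤s z≤n))

val-pPart : ∀ {p} (p>1 : 1 < p) x → 0 < x → Σ ℕ λ m → (x ≡ p ^ val p p>1 x * m) × ¬ (p ∣ m)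
val-pPart p>1 x@(suc _) _ = let open PPart (pPart p>1 x (s≤s z≤n)) in cofactor , splits , coprime

pPart-unique : ∀ {p} → 1 < p → ∀ k j m n → p ^ k * m ≡ p ^ j * n → ¬ (p ∣ m) → ¬ (p ∣ n) → k ≡ j
pPart-unique p>1 zero zero m n eq p∤m p∤n = refl
pPart-unique {p} p>1 zero (suc j) m n eq p∤m p∤n =
  ⊥-elim (p∤m (divides (p ^ j * n) (trans (trans (sym (+-identityʳ m)) eq)
    (trans (*-assoc p (p ^ j) n) (*-comm p (p ^ j * n))))))
pPart-unique p>1 (suc k) zero m n eq p∤m p∤n = sym (pPart-unique p>1 zero (suc k) n m (sym eq) p∤n p∤m)
pPart-unique {p} p>1 (suc k) (suc j) m n eq p∤m p∤n =
  cong suc (pPart-unique p>1 k j m n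
    (*-cancelˡ-≡ (p ^ k * m) (p ^ j * n) p
      (trans (sym (*-assoc p (p ^ k) m)) (trans eq (*-assoc p (p ^ j) n)))) p∤m p∤n)
  where instance _ = >-nonZero (<-trans (s≤s z≤n) p>1)

val-unique : ∀ {p} (p>1 : 1 < p) x k m → 0 < x → x ≡ p ^ k * m → ¬ (p ∣ m) → val p p>1 x ≡ k
val-unique p>1 x k m x>0 eq p∤m with val-pPart p>1 x x>0
... | m' , eq' , p∤m' = pPart-unique p>1 _ k m' m (trans (sym eq') eq) p∤m' p∤m

val-∤ : ∀ {p} (p>1 : 1 < p) x → 0 < x → ¬ (p ∣ x) → val p p>1 x ≡ 0
val-∤ p>1 x x>0 p∤x = val-unique p>1 x 0 x x>0 (sym (+-identityʳ x)) p∤x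

val-∣ : ∀ {p} (p>1 : 1 < p) x → 0 < x → p ∣ x → 1 ≤ val p p>1 x
val-∣ {p} p>1 x x>0 p∣x with val p p>1 x | val-pPart p>1 x x>0
... | zero  | m , eq , p∤m = ⊥-elim (p∤m (subst (p ∣_) (trans eq (+-identityʳ m)) p∣x))
... | suc _ | _ = s≤s z≤n

val>0⇒∣ : ∀ {p} (p>1 : 1 < p) x → 0 < x → 1 ≤ val p p>1 x → p ∣ x
val>0⇒∣ {p} p>1 x x>0 _ with val p p>1 x | val-pPart p>1 x x>0
... | suc v | m , eq , _ = divides (p ^ v * m) (trans eq (trans (*-assoc p (p ^ v) m) (*-comm p (p ^ v * m))))

val-1 : ∀ {p} (p>1 : 1 < p) → val p p>1 1 ≡ 0
val-1 p>1 = val-∤ p>1 1 (s≤s z≤n) (λ p∣1 → <⇒≱ p>1 (∣⇒≤ p∣1))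

val-self : ∀ {p} (p>1 : 1 < p) → val p p>1 p ≡ 1
val-self {p} p>1 = val-unique p>1 p 1 1 (<-trans (s≤s z≤n) p>1)
  (sym (trans (*-identityʳ (p * 1)) (*-identityʳ p))) (λ p∣1 → <⇒≱ p>1 (∣⇒≤ p∣1))

-- For a prime p the valuation is additive (Euclid's lemma keeps the cofactor prime to p).
val-* : ∀ {p} (pp : Prime p) x y → 0 < x → 0 < y →
        val p (prime>1 pp) (x * y) ≡ val p (prime>1 pp) x + val p (prime>1 pp) y
val-* {p} pp x y x>0 y>0 with val-pPart (prime>1 pp) x x>0 | val-pPart (prime>1 pp) y y>0
... | m , x-split , p∤m | n , y-split , p∤n =
  val-unique p>1 (x * y) (vx + vy) (m * n) (*-mono-< x>0 y>0) xy-split p∤mn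
  where
  p>1 = prime>1 pp
  vx = val p p>1 x
  vy = val p p>1 y
  xy-split : x * y ≡ p ^ (vx + vy) * (m * n)
  xy-split = begin
    x * y                       ≡⟨ cong₂ _*_ x-split y-split ⟩
    p ^ vx * m * (p ^ vy * n)   ≡⟨ *-assoc (p ^ vx) m (p ^ vy * n) ⟩
    p ^ vx * (m * (p ^ vy * n)) ≡⟨ cong (p ^ vx *_) (x∙yz≈y∙xz m (p ^ vy) n) ⟩
    p ^ vx * (p ^ vy * (m * n)) ≡⟨ *-assoc (p ^ vx) (p ^ vy) (m * n) ⟨
    p ^ vx * p ^ vy * (m * n)   ≡⟨ cong (_* (m * n)) (^-distribˡ-+-* p vx vy) ⟨
    p ^ (vx + vy) * (m * n)     ∎
    where open ≡-Reasoning
  p∤mn : ¬ (p ∣ m * n)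
  p∤mn p∣mn with euclidsLemma m n pp p∣mn
  ... | inj₁ p∣m = p∤m p∣m
  ... | inj₂ p∣n = p∤n p∣n

-- By strong induction on x: a prime factor p of x also divides y, and x / p, y / p inherit the
-- hypothesis.
ValLe : ℕ → ℕ → Set
ValLe x y = ∀ p (pp : Prime p) → val p (prime>1 pp) x ≤ val p (prime>1 pp) y

val-criterion : ∀ x y → 0 < x → 0 < y → ValLe x y → x ∣ y
val-criterion = <-rec (λ x → ∀ y → 0 < x → 0 < y → ValLe x y → x ∣ y) step
  where
  step : ∀ x → (∀ {x'} → x' < x → ∀ y → 0 < x' → 0 < y → ValLe x' y → x' ∣ y) →
         ∀ y → 0 < x → 0 < y → ValLe x y → x ∣ y
  step 1 _ y _ _ _ = 1∣ y
  step x@(2+ _) rec y x>0 y>0 x≤y with primeFactor x (s≤s (s≤s z≤n))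
  ... | p , pp , divides x' x≡x'*p =
    subst (_∣ y) (sym x≡x'*p) (subst (x' * p ∣_) (sym y≡y'*p) (*-monoˡ-∣ p (rec x'<x y' x'>0 y'>0 x'≤y')))
    where
    p>1 = prime>1 pp
    p>0 = <-trans (s≤s z≤n) p>1
    p∣y : p ∣ y
    p∣y = val>0⇒∣ p>1 y y>0 (≤-trans (val-∣ p>1 x x>0 (divides x' x≡x'*p)) (x≤y p pp))
    y' = quotient p∣y
    y≡y'*p = m∣n⇒n≡quotient*m p∣y
    x'>0 = quotient-pos x>0 x≡x'*p
    y'>0 = quotient-pos y>0 y≡y'*p
    x'<x : x' < x
    x'<x = subst (x' <_) (sym x≡x'*p) (m<m*n x' p p>1)
      where instance _ = >-nonZero x'>0
    x'≤y' : ValLe x' y'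
    x'≤y' r pr = +-cancelʳ-≤ (val r r>1 p) _ _
      (subst₂ _≤_ (val-* pr x' p x'>0 p>0) (val-* pr y' p y'>0 p>0)
        (subst₂ (λ s t → val r r>1 s ≤ val r r>1 t) x≡x'*p y≡y'*p (x≤y r pr)))
      where r>1 = prime>1 pr

^-pos : ∀ b n → 1 ≤ b → 1 ≤ b ^ n
^-pos b zero _ = s≤s z≤n
^-pos b (suc n) b≥1 = *-mono-≤ b≥1 (^-pos b n b≥1)

^-≥2 : ∀ b n → 2 ≤ b → 1 ≤ n → 2 ≤ b ^ n
^-≥2 b (suc n) b≥2 _ = *-mono-≤ b≥2 (^-pos b n (≤-trans (s≤s z≤n) b≥2))

even-or-odd : ∀ n → (Σ ℕ λ k → n ≡ 2 * k) ⊎ (Σ ℕ λ k → n ≡ suc (2 * k))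
even-or-odd zero = inj₁ (0 , refl)
even-or-odd (suc n) with even-or-odd n
... | inj₁ (k , n≡2k) = inj₂ (k , cong suc n≡2k)
... | inj₂ (k , n≡2k+1) = inj₁ (suc k , trans (cong suc n≡2k+1) (cong suc (sym (+-suc k (k + 0)))))

prime∣prime : ∀ {p q} → Prime p → Prime q → p ∣ q → p ≡ q
prime∣prime pp pq p∣q with prime⇒irreducible pq p∣q
... | inj₁ refl = ⊥-elim (<⇒≱ (prime>1 pp) ≤-refl)
... | inj₂ p≡q = p≡q

odd-prime : ∀ p → Prime p → p ≢ 2 → Σ ℕ λ k → p ≡ suc (2 * k)
odd-prime p pp p≢2 with even-or-odd p
... | inj₂ odd = odd
... | inj₁ (k , p≡2k) = ⊥-elim (p≢2 (sym (prime∣prime prime[2] pp (divides k (trans p≡2k (*-comm 2 k))))))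

u : ℕ → ℕ → ℕ
u b n = b ^ n ∸ 1

u-pos : ∀ b n → 2 ≤ b → 1 ≤ n → 1 ≤ u b n
u-pos b n b≥2 n≥1 = ∸-monoˡ-≤ 1 (^-≥2 b n b≥2 n≥1)

^≡1+u : ∀ b n → 1 ≤ b → b ^ n ≡ suc (u b n)
^≡1+u b n b≥1 with b ^ n | ^-pos b n b≥1
... | suc _ | _ = refl

u-+ : ∀ b m n → 1 ≤ b → u b (m + n) ≡ b ^ m * u b n + u b m
u-+ b m n b≥1 = begin
  b ^ (m + n) ∸ 1                 ≡⟨ cong (_∸ 1) (^-distribˡ-+-* b m n) ⟩
  b ^ m * b ^ n ∸ 1               ≡⟨ cong₂ (λ s t → s * t ∸ 1) (^≡1+u b m b≥1) (^≡1+u b n b≥1) ⟩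
  suc (u b m) * suc (u b n) ∸ 1   ≡⟨ expand (u b n) (u b m) ⟩
  suc (u b m) * u b n + u b m     ≡⟨ cong (λ s → s * u b n + u b m) (^≡1+u b m b≥1) ⟨
  b ^ m * u b n + u b m           ∎
  where
  open ≡-Reasoning
  expand : ∀ y z → y + z * suc y ≡ suc z * y + z
  expand = solve-∀

u-^ : ∀ b n q → u b (q * n) ≡ u (b ^ n) q
u-^ b n q = cong (_∸ 1) (trans (cong (b ^_) (*-comm q n)) (sym (^-*-assoc b n q)))

u-∣-* : ∀ b e s → 1 ≤ b → u b e ∣ u b (e * s)
u-∣-* b e zero b≥1 rewrite *-zeroʳ e = u b e ∣0
u-∣-* b e (suc s) b≥1 rewrite *-suc e s | u-+ b e (e * s) b≥1 =
  ∣m∣n⇒∣m+n (∣n⇒∣m*n (b ^ e) (u-∣-* b e s b≥1)) ∣-refl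

u-∣ : ∀ b {d n} → 1 ≤ b → d ∣ n → u b d ∣ u b n
u-∣ b {d} b≥1 (divides s n≡s*d) = subst (λ m → u b d ∣ u b m) (sym (trans n≡s*d (*-comm s d))) (u-∣-* b d s b≥1)

LeastWitness : (ℕ → Set) → Set
LeastWitness P = Σ ℕ λ e → 1 ≤ e × P e × (∀ j → 1 ≤ j → j < e → ¬ P j)

leastWitness : ∀ {P : ℕ → Set} → (∀ n → Dec (P n)) → ∀ N → 1 ≤ N → P N → LeastWitness P
leastWitness {P} P? = <-rec (λ N → 1 ≤ N → P N → LeastWitness P) step
  where
  step : ∀ N → (∀ {j} → j < N → 1 ≤ j → P j → LeastWitness P) → 1 ≤ N → P N → LeastWitness P
  step N rec N≥1 pN with anyUpTo? (λ j → (1 ≤? j) ×-dec P? j) N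
  ... | yes (j , j<N , j≥1 , pj) = rec j<N j≥1 pj
  ... | no none = N , N≥1 , pN , λ j j≥1 j<N pj → none (j , j<N , j≥1 , pj)

record Order (b p : ℕ) : Set where
  field
    e        : ℕ
    e≥1      : 1 ≤ e
    p∣u      : p ∣ u b e
    divides⇒ : ∀ n → p ∣ u b n → e ∣ n

order : ∀ b p N → 1 ≤ b → 1 ≤ N → p ∣ u b N → Order b p
order b p N b≥1 N≥1 p∣uN with leastWitness (λ n → p ∣? u b n) N N≥1 p∣uN
... | e , e≥1 , p∣ue , minimal = record
  { e = e ; e≥1 = e≥1 ; p∣u = p∣ue ; divides⇒ = char }
  where
  instance _ = >-nonZero e≥1
  -- Writing n = r + e q, the relation u b n = b ^ r * u b (e q) + u b r shows p ∣ u b r, so r = 0.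
  char : ∀ n → p ∣ u b n → e ∣ n
  char n p∣un with n % e in n%e≡r | m%n<n n e
  ... | zero  | _ = m%n≡0⇒n∣m n e n%e≡r
  ... | suc r | r<e = ⊥-elim (minimal (suc r) (s≤s z≤n) r<e p∣ur)
    where
    n-split : n ≡ suc r + e * (n / e)
    n-split = trans (m≡m%n+[m/n]*n n e) (cong₂ _+_ n%e≡r (*-comm (n / e) e))
    p∣sum : p ∣ b ^ suc r * u b (e * (n / e)) + u b (suc r)
    p∣sum = subst (p ∣_) (trans (cong (u b) n-split) (u-+ b (suc r) (e * (n / e)) b≥1)) p∣un
    p∣ur : p ∣ u b (suc r)
    p∣ur = ∣m+n∣m⇒∣n p∣sum (∣n⇒∣m*n (b ^ suc r) (∣-trans p∣ue (u-∣-* b e (n / e) b≥1)))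

order-∣ : ∀ {b p} → 1 ≤ b → (o : Order b p) → ∀ n → Order.e o ∣ n → p ∣ u b n
order-∣ {b} b≥1 o n e∣n = ∣-trans (Order.p∣u o) (u-∣ b b≥1 e∣n)

-- If 2 ∣ b ^ e - 1 then b is odd, so already 2 ∣ b - 1.
two∣u⇒two∣u1 : ∀ b e → 1 ≤ b → 1 ≤ e → 2 ∣ u b e → 2 ∣ u b 1
two∣u⇒two∣u1 b (suc e) b≥1 _ 2∣ue with even-or-odd b
... | inj₂ (k , b≡2k+1) = divides k (trans (cong (_∸ 1) (trans (*-identityʳ b) b≡2k+1)) (*-comm 2 k))
... | inj₁ (k , b≡2k) = ⊥-elim (<⇒≱ (s≤s (s≤s z≤n)) (∣⇒≤ (∣m+n∣m⇒∣n 2∣1+ue 2∣ue)))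
  where
  2∣b^e : 2 ∣ b ^ suc e
  2∣b^e = ∣m⇒∣m*n (b ^ e) (divides k (trans b≡2k (*-comm 2 k)))
  2∣1+ue : 2 ∣ u b (suc e) + 1
  2∣1+ue = subst (2 ∣_) (trans (^≡1+u b (suc e) b≥1) (+-comm 1 (u b (suc e)))) 2∣b^e

gs : ℕ → ℕ → ℕ
gs x zero = 0
gs x (suc n) = x ^ n + gs x n

pow-gs : ∀ y n → suc y ^ n ≡ 1 + y * gs (suc y) n
pow-gs y zero = cong suc (sym (*-zeroʳ y))
pow-gs y (suc n) = begin
  suc y * suc y ^ n                               ≡⟨ cong (suc y *_) (pow-gs y n) ⟩
  suc y * (1 + y * gs (suc y) n)                  ≡⟨ expand y (gs (suc y) n) ⟩
  1 + y * ((1 + y * gs (suc y) n) + gs (suc y) n) ≡⟨ cong (λ z → 1 + y * (z + gs (suc y) n)) (pow-gs y n) ⟨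
  1 + y * (suc y ^ n + gs (suc y) n)              ∎
  where
  open ≡-Reasoning
  expand : ∀ y g → suc y * (1 + y * g) ≡ 1 + y * ((1 + y * g) + g)
  expand = solve-∀

u-gs : ∀ y n → u (suc y) n ≡ y * gs (suc y) n
u-gs y n = cong (_∸ 1) (pow-gs y n)

gs-pos : ∀ x n → 1 ≤ x → 1 ≤ n → 1 ≤ gs x n
gs-pos x (suc n) x≥1 _ = ≤-trans (^-pos x n x≥1) (m≤m+n (x ^ n) (gs x n))

gs-mod : ∀ p t n → Σ ℕ λ r → gs (suc (p * t)) n ≡ n + p * r
gs-mod p t zero = 0 , sym (*-zeroʳ p)
gs-mod p t (suc n) with gs-mod p t n
... | r , gs≡n+pr = t * gs (suc (p * t)) n + r , (begin
  suc (p * t) ^ n + gs (suc (p * t)) n             ≡⟨ cong₂ _+_ (pow-gs (p * t) n) gs≡n+pr ⟩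
  (1 + p * t * gs (suc (p * t)) n) + (n + p * r)   ≡⟨ regroup p t (gs (suc (p * t)) n) n r ⟩
  suc n + p * (t * gs (suc (p * t)) n + r)         ∎)
  where
  open ≡-Reasoning
  regroup : ∀ p t g n r → (1 + p * t * g) + (n + p * r) ≡ suc n + p * (t * g + r)
  regroup = solve-∀

lte-coprime : ∀ {p} (pp : Prime p) q y → ¬ (p ∣ q) → 1 ≤ y → p ∣ y →
              val p (prime>1 pp) (u (suc y) q) ≡ val p (prime>1 pp) y
lte-coprime {p} pp q y p∤q y≥1 (divides t y≡t*p) = begin
  val p p>1 (u (suc y) q)                     ≡⟨ cong (val p p>1) (u-gs y q) ⟩
  val p p>1 (y * gs (suc y) q)                ≡⟨ val-* pp y _ y≥1 gs>0 ⟩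
  val p p>1 y + val p p>1 (gs (suc y) q)      ≡⟨ cong (val p p>1 y +_) (val-∤ p>1 _ gs>0 p∤gs) ⟩
  val p p>1 y + 0                             ≡⟨ +-identityʳ _ ⟩
  val p p>1 y                                 ∎
  where
  open ≡-Reasoning
  p>1 = prime>1 pp
  gs>0 = gs-pos (suc y) q (s≤s z≤n) (n≢0⇒n>0 (λ { refl → p∤q (p ∣0) }))
  y≡p*t = trans y≡t*p (*-comm t p)
  -- gs (1 + y) q ≡ q (mod p) is prime to p
  p∤gs : ¬ (p ∣ gs (suc y) q)
  p∤gs p∣gs with gs-mod p t q
  ... | r , gs≡q+pr = p∤q (∣m+n∣m⇒∣n (subst (p ∣_) gs≡pr+q p∣gs) (m∣m*n r))
    where
    gs≡pr+q : gs (suc y) q ≡ p * r + q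
    gs≡pr+q = trans (cong (λ z → gs (suc z) q) y≡p*t) (trans gs≡q+pr (+-comm q (p * r)))

pow-mod-sq : ∀ y j → Σ ℕ λ R → suc y ^ j ≡ 1 + j * y + y * y * R
pow-mod-sq y zero = 0 , cong suc (sym (*-zeroʳ (y * y)))
pow-mod-sq y (suc j) with pow-mod-sq y j
... | R , eq = R + j + y * R , (begin
  suc y * suc y ^ j                       ≡⟨ cong (suc y *_) eq ⟩
  suc y * (1 + j * y + y * y * R)         ≡⟨ expand y j R ⟩
  1 + suc j * y + y * y * (R + j + y * R) ∎)
  where
  open ≡-Reasoning
  expand : ∀ y j R → suc y * (1 + j * y + y * y * R) ≡ 1 + suc j * y + y * y * (R + j + y * R)
  expand = solve-∀

tri : ℕ → ℕ
tri zero = 0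
tri (suc n) = n + tri n

tri-odd : ∀ k → tri (suc (2 * k)) ≡ suc (2 * k) * k
tri-odd zero = refl
tri-odd (suc k) = begin
  tri (suc (2 * suc k))                     ≡⟨ cong (λ m → tri (suc m)) (*-suc 2 k) ⟩
  (2 + 2 * k) + ((1 + 2 * k) + tri (suc (2 * k))) ≡⟨ cong (λ z → (2 + 2 * k) + ((1 + 2 * k) + z)) (tri-odd k) ⟩
  (2 + 2 * k) + ((1 + 2 * k) + suc (2 * k) * k) ≡⟨ expand k ⟩
  suc (2 * suc k) * suc k                   ∎
  where
  open ≡-Reasoning
  expand : ∀ k → (2 + 2 * k) + ((1 + 2 * k) + suc (2 * k) * k) ≡ suc (2 * suc k) * suc k
  expand = solve-∀

gs-mod-sq : ∀ y n → Σ ℕ λ R → gs (suc y) n ≡ n + tri n * y + y * y * R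
gs-mod-sq y zero = 0 , sym (*-zeroʳ (y * y))
gs-mod-sq y (suc n) with pow-mod-sq y n | gs-mod-sq y n
... | R₁ , eq₁ | R , eq = R₁ + R , (begin
  suc y ^ n + gs (suc y) n                                          ≡⟨ cong₂ _+_ eq₁ eq ⟩
  (1 + n * y + y * y * R₁) + (n + tri n * y + y * y * R)            ≡⟨ regroup y n (tri n) R₁ R ⟩
  suc n + (n + tri n) * y + y * y * (R₁ + R)                        ∎)
  where
  open ≡-Reasoning
  regroup : ∀ y n T R₁ R → (1 + n * y + y * y * R₁) + (n + T * y + y * y * R) ≡ suc n + (n + T) * y + y * y * (R₁ + R)
  regroup = solve-∀

lte-odd : ∀ {p} (pp : Prime p) → p ≢ 2 → ∀ y → 1 ≤ y → p ∣ y →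
          val p (prime>1 pp) (u (suc y) p) ≡ val p (prime>1 pp) y + 1
lte-odd {p} pp p≢2 y y≥1 (divides t y≡t*p) with odd-prime p pp p≢2
... | k , refl with gs-mod-sq y p
... | R , gs≡ = begin
  val p p>1 (u (suc y) p)                               ≡⟨ cong (val p p>1) (u-gs y p) ⟩
  val p p>1 (y * gs (suc y) p)                          ≡⟨ cong (λ z → val p p>1 (y * z)) gs≡p*[1+pw] ⟩
  val p p>1 (y * (p * (1 + p * w)))                     ≡⟨ val-* pp y _ y≥1 (*-mono-< p>0 (s≤s z≤n)) ⟩
  val p p>1 y + val p p>1 (p * (1 + p * w))             ≡⟨ cong (val p p>1 y +_) (val-* pp p (1 + p * w) p>0 (s≤s z≤n)) ⟩
  val p p>1 y + (val p p>1 p + val p p>1 (1 + p * w))   ≡⟨ cong₂ (λ a b → val p p>1 y + (a + b))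
                                                                 (val-self p>1) (val-∤ p>1 _ (s≤s z≤n) p∤1+pw) ⟩
  val p p>1 y + 1                                       ∎
  where
  open ≡-Reasoning
  p>1 = prime>1 pp
  p>0 : 0 < p
  p>0 = s≤s z≤n
  w = t * k + t * t * R
  -- gs (1 + y) p ≡ p + tri p y ≡ p (mod p²), because p ∣ tri p and p ∣ y
  gs≡p*[1+pw] : gs (suc y) p ≡ p * (1 + p * w)
  gs≡p*[1+pw] = begin
    gs (suc y) p                          ≡⟨ gs≡ ⟩
    p + tri p * y + y * y * R             ≡⟨ cong₂ (λ a b → p + a * b + b * b * R) (tri-odd k) y≡t*p ⟩
    p + p * k * (t * p) + t * p * (t * p) * R ≡⟨ factor p k t R ⟩
    p * (1 + p * w)                       ∎
    where
    factor : ∀ p k t R → p + p * k * (t * p) + t * p * (t * p) * R ≡ p * (1 + p * (t * k + t * t * R))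
    factor = solve-∀
  p∤1+pw : ¬ (p ∣ 1 + p * w)
  p∤1+pw p∣ = <⇒≱ p>1 (∣⇒≤ (∣m+n∣m⇒∣n (subst (p ∣_) (+-comm 1 (p * w)) p∣) (m∣m*n w)))

-- For Q = q₁ … qₖ (later: the distinct primes dividing M = q₁ ⋯ qₖ) the divisors d of ∏ Q
-- split according to the sign of μ(∏ Q / d).  signedFold _∙_ ε s f Q combines the values f d
-- over the divisors of sign s (true: μ = +1, false: μ = −1).  The divisors of q ∏ Q are the
-- q d, with the sign of d, and the d, with the opposite sign.
signedFold : (ℕ → ℕ → ℕ) → ℕ → Bool → (ℕ → ℕ) → List ℕ → ℕ
signedFold _∙_ ε s f (q ∷ Q) = signedFold _∙_ ε s (λ n → f (q * n)) Q ∙ signedFold _∙_ ε (not s) f Q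
signedFold _∙_ ε true  f [] = f 1
signedFold _∙_ ε false f [] = ε

-- For squarefree M = ∏ Q the quotient
-- Π± true (u b) Q / Π± false (u b) Q is the cyclotomic value Φ_M(b); only the two products are
-- used below.
Σ± : Bool → (ℕ → ℕ) → List ℕ → ℕ
Σ± = signedFold _+_ 0

Π± : Bool → (ℕ → ℕ) → List ℕ → ℕ
Π± = signedFold _*_ 1

signedFold-cong : ∀ {_∙_ ε} s {f g} Q → (∀ n → f n ≡ g n) → signedFold _∙_ ε s f Q ≡ signedFold _∙_ ε s g Q
signedFold-cong true  [] f≗g = f≗g 1
signedFold-cong false [] f≗g = refl
signedFold-cong {_∙_} s (q ∷ Q) f≗g =
  cong₂ _∙_ (signedFold-cong s Q (λ n → f≗g (q * n))) (signedFold-cong (not s) Q f≗g)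

*-swap-inside : ∀ (f : ℕ → ℕ) y p n → f (y * (p * n)) ≡ f (p * (y * n))
*-swap-inside f y p n = cong f (trans (sym (*-assoc y p n)) (trans (cong (_* n) (*-comm y p)) (*-assoc p y n)))

Σ±-move : ∀ s f (ys : List ℕ) p zs → Σ± s f (ys ++ p ∷ zs) ≡ Σ± s f (p ∷ ys ++ zs)
Σ±-move s f [] p zs = refl
Σ±-move s f (y ∷ ys) p zs rewrite Σ±-move s (λ n → f (y * n)) ys p zs | Σ±-move (not s) f ys p zs
                                | not-involutive s = begin
  (Σ± s (λ n → f (y * (p * n))) R + Σ± (not s) (λ n → f (y * n)) R) + (Σ± (not s) (λ n → f (p * n)) R + Σ± s f R)
    ≡⟨ cong (λ z → (z + Σ± (not s) (λ n → f (y * n)) R) + (Σ± (not s) (λ n → f (p * n)) R + Σ± s f R))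
            (signedFold-cong s R (*-swap-inside f y p)) ⟩
  (Σ± s (λ n → f (p * (y * n))) R + Σ± (not s) (λ n → f (y * n)) R) + (Σ± (not s) (λ n → f (p * n)) R + Σ± s f R)
    ≡⟨ middle-swap (Σ± s (λ n → f (p * (y * n))) R) (Σ± (not s) (λ n → f (y * n)) R)
                   (Σ± (not s) (λ n → f (p * n)) R) (Σ± s f R) ⟩
  (Σ± s (λ n → f (p * (y * n))) R + Σ± (not s) (λ n → f (p * n)) R) + (Σ± (not s) (λ n → f (y * n)) R + Σ± s f R) ∎
  where
  open ≡-Reasoning
  R = ys ++ zs
  middle-swap : ∀ a b c d → (a + b) + (c + d) ≡ (a + c) + (b + d)
  middle-swap = solve-∀

-- If f is invariant under n ↦ q n for some q ∈ Q, the divisors of either sign contribute equally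
-- (they are paired by d ↔ q d).
Σ±-invariant : ∀ f {q} Q → q ∈ Q → (∀ n → f (q * n) ≡ f n) → Σ± true f Q ≡ Σ± false f Q
Σ±-invariant f {q} Q q∈Q f-inv with ∈-∃++ q∈Q
... | ys , zs , refl = begin
  Σ± true f (ys ++ q ∷ zs)                            ≡⟨ Σ±-move true f ys q zs ⟩
  Σ± true (λ n → f (q * n)) R + Σ± false f R          ≡⟨ cong (_+ Σ± false f R) (signedFold-cong true R f-inv) ⟩
  Σ± true f R + Σ± false f R                          ≡⟨ +-comm (Σ± true f R) _ ⟩
  Σ± false f R + Σ± true f R                          ≡⟨ cong (_+ Σ± true f R) (signedFold-cong false R f-inv) ⟨
  Σ± false (λ n → f (q * n)) R + Σ± true f R          ≡⟨ Σ±-move false f ys q zs ⟨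
  Σ± false f (ys ++ q ∷ zs)                           ∎
  where
  open ≡-Reasoning
  R = ys ++ zs

divisor-pos : ∀ {d n} → 1 ≤ n → d ∣ n → 1 ≤ d
divisor-pos {zero} n≥1 d∣n = ⊥-elim (<⇒≢ n≥1 (sym (0∣⇒≡0 d∣n)))
divisor-pos {suc d} _ _ = s≤s z≤n

product-pos : ∀ {Q} → All (1 <_) Q → 0 < product Q
product-pos [] = s≤s z≤n
product-pos (q>1 ∷ Q>1) = *-mono-< (<-trans (s≤s z≤n) q>1) (product-pos Q>1)

Σ±-top : ∀ f Q → All (1 <_) Q → (∀ d → d ∣ product Q → d ≢ product Q → f d ≡ 0) →
         Σ± true f Q ≡ f (product Q) × Σ± false f Q ≡ 0
Σ±-top f [] _ _ = refl , refl
Σ±-top f (q ∷ Q) (q>1 ∷ Q>1) vanish =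
  trans (cong₂ _+_ (proj₁ IH-q) (proj₂ IH)) (+-identityʳ _) ,
  trans (cong₂ _+_ (proj₂ IH-q) (proj₁ IH)) (vanish P (n∣m*n q) P≢qP)
  where
  P = product Q
  instance _ = >-nonZero (product-pos Q>1)
  P<qP : P < q * P
  P<qP = subst (P <_) (*-comm P q) (m<m*n P q q>1)
  P≢qP : P ≢ q * P
  P≢qP = <⇒≢ P<qP
  IH-q = Σ±-top (λ n → f (q * n)) Q Q>1
           (λ d d∣P d≢P → vanish (q * d) (*-monoʳ-∣ q d∣P) (λ qd≡qP → d≢P (*-cancelˡ-≡ d P q qd≡qP)))
    where instance _ = >-nonZero (<-trans (s≤s z≤n) q>1)
  IH = Σ±-top f Q Q>1
         (λ d d∣P _ → vanish d (∣-trans d∣P (n∣m*n q)) (λ d≡qP → <⇒≱ P<qP (subst (_≤ P) d≡qP (∣⇒≤ d∣P))))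

Σ±-two-tops : ∀ f p Q' → All (1 <_) Q' →
              (∀ d → d ∣ product Q' → d ≢ product Q' → f d ≡ 0 × f (p * d) ≡ 0) →
              Σ± true f (p ∷ Q') ≡ f (p * product Q') × Σ± false f (p ∷ Q') ≡ f (product Q')
Σ±-two-tops f p Q' Q'>1 vanish =
  trans (cong₂ _+_ (proj₁ top-p*) (proj₂ top)) (+-identityʳ _) ,
  trans (cong (_+ Σ± true f Q') (proj₂ top-p*)) (proj₁ top)
  where
  top = Σ±-top f Q' Q'>1 (λ d d∣E d≢E → proj₁ (vanish d d∣E d≢E))
  top-p* = Σ±-top (λ n → f (p * n)) Q' Q'>1 (λ d d∣E d≢E → proj₂ (vanish d d∣E d≢E))

-- Euler's totient of a squarefree number, from its list of prime factors.
totient : List ℕ → ℕ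
totient [] = 1
totient (q ∷ Q) = (q ∸ 1) * totient Q

-- Möbius inversion of the identity: Σ_{d ∣ M} μ(M/d) c d = c φ(M).
Σ±-linear : ∀ c Q → All (1 ≤_) Q → Σ± true (c *_) Q ≡ Σ± false (c *_) Q + c * totient Q
Σ±-linear c [] _ = refl
Σ±-linear c (q ∷ Q) (q≥1 ∷ Q≥1) = begin
  Σ± true (λ n → c * (q * n)) Q + Σ± false (c *_) Q
    ≡⟨ cong (_+ Σ± false (c *_) Q) (signedFold-cong true Q (λ n → sym (*-assoc c q n))) ⟩
  Σ± true (c * q *_) Q + Σ± false (c *_) Q
    ≡⟨ cong (_+ Σ± false (c *_) Q) (Σ±-linear (c * q) Q Q≥1) ⟩
  (Σ± false (c * q *_) Q + c * q * totient Q) + Σ± false (c *_) Q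
    ≡⟨ cong (λ z → (Σ± false (c * q *_) Q + c * z * totient Q) + Σ± false (c *_) Q) (sym (m+[n∸m]≡n q≥1)) ⟩
  (Σ± false (c * q *_) Q + c * suc (q ∸ 1) * totient Q) + Σ± false (c *_) Q
    ≡⟨ regroup (Σ± false (c * q *_) Q) (Σ± false (c *_) Q) c (q ∸ 1) (totient Q) ⟩
  Σ± false (c * q *_) Q + (Σ± false (c *_) Q + c * totient Q) + c * ((q ∸ 1) * totient Q)
    ≡⟨ cong₂ (λ a b → a + b + c * ((q ∸ 1) * totient Q))
             (signedFold-cong false Q (λ n → *-assoc c q n)) (sym (Σ±-linear c Q Q≥1)) ⟩
  Σ± false (λ n → c * (q * n)) Q + Σ± true (c *_) Q + c * ((q ∸ 1) * totient Q) ∎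
  where
  open ≡-Reasoning
  regroup : ∀ a b c k t → (a + c * suc k * t) + b ≡ a + (b + c * t) + c * (k * t)
  regroup = solve-∀

Σ±-id : ∀ Q → All (1 ≤_) Q → Σ± true (λ n → n) Q ≡ Σ± false (λ n → n) Q + totient Q
Σ±-id Q Q≥1 = begin
  Σ± true (λ n → n) Q                 ≡⟨ signedFold-cong true Q (λ n → sym (*-identityˡ n)) ⟩
  Σ± true (1 *_) Q                    ≡⟨ Σ±-linear 1 Q Q≥1 ⟩
  Σ± false (1 *_) Q + 1 * totient Q   ≡⟨ cong₂ _+_ (signedFold-cong false Q *-identityˡ) (*-identityˡ _) ⟩
  Σ± false (λ n → n) Q + totient Q    ∎
  where open ≡-Reasoning

Σ±-count : ∀ s q Q → Σ± s (λ _ → 1) (q ∷ Q) ≡ 2 ^ length Q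
Σ±-count true  q [] = refl
Σ±-count false q [] = refl
Σ±-count s q (q' ∷ Q) = trans (cong₂ _+_ (Σ±-count s q' Q) (Σ±-count (not s) q' Q))
                              (cong (2 ^ length Q +_) (sym (+-identityʳ (2 ^ length Q))))

-- Positivity, monotonicity and multiplicativity of Π±; only values at n ≥ 1 matter, since Q
-- consists of positive numbers.
Positive : (ℕ → ℕ) → Set
Positive f = ∀ n → 1 ≤ n → 1 ≤ f n

Π±-pos : ∀ s f Q → All (1 ≤_) Q → Positive f → 1 ≤ Π± s f Q
Π±-pos true  f [] _ f>0 = f>0 1 (s≤s z≤n)
Π±-pos false f [] _ _ = s≤s z≤n
Π±-pos s f (q ∷ Q) (q≥1 ∷ Q≥1) f>0 =
  *-mono-≤ (Π±-pos s _ Q Q≥1 (λ n n≥1 → f>0 (q * n) (*-mono-≤ q≥1 n≥1))) (Π±-pos (not s) f Q Q≥1 f>0)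

Π±-mono : ∀ s f g Q → All (1 ≤_) Q → (∀ n → 1 ≤ n → f n ≤ g n) → Π± s f Q ≤ Π± s g Q
Π±-mono true  f g [] _ f≤g = f≤g 1 (s≤s z≤n)
Π±-mono false f g [] _ _ = ≤-refl
Π±-mono s f g (q ∷ Q) (q≥1 ∷ Q≥1) f≤g =
  *-mono-≤ (Π±-mono s _ _ Q Q≥1 (λ n n≥1 → f≤g (q * n) (*-mono-≤ q≥1 n≥1))) (Π±-mono (not s) f g Q Q≥1 f≤g)

Π±-* : ∀ s f g Q → Π± s (λ n → f n * g n) Q ≡ Π± s f Q * Π± s g Q
Π±-* true  f g [] = refl
Π±-* false f g [] = refl
Π±-* s f g (q ∷ Q) = trans (cong₂ _*_ (Π±-* s _ _ Q) (Π±-* (not s) f g Q))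
                           (interchange (Π± s _ Q) (Π± s _ Q) (Π± (not s) f Q) (Π± (not s) g Q))
  where
  interchange : ∀ a b c d → (a * b) * (c * d) ≡ (a * c) * (b * d)
  interchange = solve-∀

Π±-^ : ∀ s c g Q → Π± s (λ n → c ^ g n) Q ≡ c ^ Σ± s g Q
Π±-^ true  c g [] = refl
Π±-^ false c g [] = refl
Π±-^ s c g (q ∷ Q) = trans (cong₂ _*_ (Π±-^ s c _ Q) (Π±-^ (not s) c g Q))
                           (sym (^-distribˡ-+-* c (Σ± s _ Q) (Σ± (not s) g Q)))

val-Π± : ∀ {p} (pp : Prime p) s f Q → All (1 ≤_) Q → Positive f →
         val p (prime>1 pp) (Π± s f Q) ≡ Σ± s (λ n → val p (prime>1 pp) (f n)) Q
val-Π± pp true  f [] _ _ = refl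
val-Π± pp false f [] _ _ = val-1 (prime>1 pp)
val-Π± pp s f (q ∷ Q) (q≥1 ∷ Q≥1) f>0 =
  trans (val-* pp _ _ (Π±-pos s fq Q Q≥1 fq>0) (Π±-pos (not s) f Q Q≥1 f>0))
        (cong₂ _+_ (val-Π± pp s fq Q Q≥1 fq>0) (val-Π± pp (not s) f Q Q≥1 f>0))
  where
  fq = λ n → f (q * n)
  fq>0 : Positive fq
  fq>0 n n≥1 = f>0 (q * n) (*-mono-≤ q≥1 n≥1)

Primitive : ℕ → ℕ → ℕ → Set
Primitive b M p = Prime p × p ∣ u b M × (∀ k → 1 ≤ k → k < M → ¬ (p ∣ u b k))

HasPrimitive : ℕ → ℕ → Set
HasPrimitive b M = Σ ℕ (Primitive b M)

NoPrimitive : ℕ → ℕ → Set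
NoPrimitive b M = ∀ p → Prime p → p ∣ u b M → Σ ℕ λ k → 1 ≤ k × k < M × p ∣ u b k

prime-cancel : ∀ {e q n} → Prime q → ¬ (q ∣ e) → e ∣ q * n → e ∣ n
prime-cancel {e} pq q∤e = coprime-divisor coprime
  where
  coprime : ∀ {i} → i ∣ e × i ∣ _ → i ≡ 1
  coprime (i∣e , i∣q) with prime⇒irreducible pq i∣q
  ... | inj₁ i≡1 = i≡1
  ... | inj₂ refl = ⊥-elim (q∤e i∣e)

distinct-primes-∣ : ∀ {n} Q → All Prime Q → Unique Q → All (_∣ n) Q → product Q ∣ n
distinct-primes-∣ {n} [] _ _ _ = 1∣ n
distinct-primes-∣ {n} (q ∷ Q) (pq ∷ pQ) (q∉Q ∷ uQ) (q∣n ∷ Q∣n) with distinct-primes-∣ Q pQ uQ Q∣n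
... | divides r n≡r*P = divides s (trans n≡r*P (trans (cong (_* P) r≡s*q) (*-assoc s q P)))
  where
  P = product Q
  q∤P : ¬ (q ∣ P)
  q∤P q∣P = All.lookup q∉Q (factorisationHasAllPrimeFactors pq q∣P pQ) refl
  q∣r : q ∣ r
  q∣r with euclidsLemma r P pq (subst (q ∣_) n≡r*P q∣n)
  ... | inj₁ q∣r = q∣r
  ... | inj₂ q∣P = ⊥-elim (q∤P q∣P)
  s = quotient q∣r
  r≡s*q = m∣n⇒n≡quotient*m q∣r

-- Writing X = Π± true (u b) Q and
-- Y = Π± false (u b) Q (so X / Y = Φ_M(b)), every prime p satisfies
-- val p X ≤ val p M + val p Y; hence X ∣ M Y, which forces b ^ φ(M) ≤ 2 ^ 2 ^ (k-1) M.
module NoPrimitiveBound (b : ℕ) (b≥2 : 2 ≤ b) (Q : List ℕ) (Q-prime : All Prime Q) (Q-unique : Unique Q)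
                        (M≥3 : 3 ≤ product Q) (no-primitive : NoPrimitive b (product Q)) where

  M = product Q
  X = Π± true (u b) Q
  Y = Π± false (u b) Q

  b≥1 : 1 ≤ b
  b≥1 = ≤-trans (s≤s z≤n) b≥2
  M≥1 : 1 ≤ M
  M≥1 = ≤-trans (s≤s z≤n) M≥3
  Q>1 : All (1 <_) Q
  Q>1 = All.map prime>1 Q-prime
  Q≥1 : All (1 ≤_) Q
  Q≥1 = All.map (λ pq → <-trans (s≤s z≤n) (prime>1 pq)) Q-prime
  u>0 : Positive (u b)
  u>0 n = u-pos b n b≥2

  module AtPrime (p : ℕ) (pp : Prime p) where
    p>1 = prime>1 pp
    v = val p p>1

    -- f n is the valuation at p of b ^ n - 1, so that val p X = Σ+ f and val p Y = Σ- f.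
    f : ℕ → ℕ
    f n = v (u b n)

    f-vanishes : ∀ n → 1 ≤ n → ¬ (p ∣ u b n) → f n ≡ 0
    f-vanishes n n≥1 p∤u = val-∤ p>1 (u b n) (u-pos b n b≥2 n≥1) p∤u

    -- p ∤ b ^ M - 1: then p divides no b ^ d - 1 with d ∣ M, and both sides vanish.
    coprime-case : ¬ (p ∣ u b M) → Σ± true f Q ≡ 0
    coprime-case p∤uM = trans (proj₁ (Σ±-top f Q Q>1 vanish)) (f-vanishes M M≥1 p∤uM)
      where
      vanish : ∀ d → d ∣ M → d ≢ M → f d ≡ 0
      vanish d d∣M _ = f-vanishes d (divisor-pos M≥1 d∣M) (λ p∣ud → p∤uM (∣-trans p∣ud (u-∣ b b≥1 d∣M)))

    -- p ∣ b ^ M - 1: the order e of b modulo p is a proper divisor of M.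
    module Dividing (p∣uM : p ∣ u b M) where
      o = order b p M b≥1 M≥1 p∣uM
      open Order o using (e; e≥1; divides⇒)

      e∣M : e ∣ M
      e∣M = divides⇒ M p∣uM

      e<M : e < M
      e<M with no-primitive p pp p∣uM
      ... | k , k≥1 , k<M , p∣uk = ≤-<-trans (∣⇒≤ (divides⇒ k p∣uk)) k<M
        where instance _ = >-nonZero k≥1

      f-off-order : ∀ n → 1 ≤ n → ¬ (e ∣ n) → f n ≡ 0
      f-off-order n n≥1 e∤n = f-vanishes n n≥1 (λ p∣un → e∤n (divides⇒ n p∣un))

      -- Some prime of Q does not divide e, since otherwise M ∣ e.
      some-q∤e : Σ ℕ λ q → q ∈ Q × ¬ (q ∣ e)
      some-q∤e with All.all? (_∣? e) Q
      ... | yes Q∣e = ⊥-elim (<⇒≱ e<M (∣⇒≤ (distinct-primes-∣ Q Q-prime Q-unique Q∣e)))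
        where instance _ = >-nonZero e≥1
      ... | no ¬Q∣e = find (¬All⇒Any¬ (_∣? e) Q ¬Q∣e)

      -- If some q ∈ Q with q ∤ e differs from p, then f (q n) = f n (lifting the exponent
      -- for e ∣ n, and both vanish otherwise), so the two signs contribute equally.
      balanced : ∀ q → q ∈ Q → ¬ (q ∣ e) → q ≢ p → Σ± true f Q ≡ Σ± false f Q
      balanced q q∈Q q∤e q≢p = Σ±-invariant f Q q∈Q f-inv
        where
        pq = All.lookup Q-prime q∈Q
        q≥1 = <-trans (s≤s z≤n) (prime>1 pq)
        f-inv : ∀ n → f (q * n) ≡ f n
        f-inv zero = cong f (*-zeroʳ q)
        f-inv n@(suc _) with e ∣? n
        ... | yes e∣n = begin
          v (u b (q * n))          ≡⟨ cong v (u-^ b n q) ⟩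
          v (u (b ^ n) q)          ≡⟨ cong (λ z → v (u z q)) (^≡1+u b n b≥1) ⟩
          v (u (suc (u b n)) q)    ≡⟨ lte-coprime pp q (u b n) p∤q (u-pos b n b≥2 (s≤s z≤n)) (order-∣ b≥1 o n e∣n) ⟩
          v (u b n)                ∎
          where
          open ≡-Reasoning
          p∤q : ¬ (p ∣ q)
          p∤q p∣q = q≢p (sym (prime∣prime pp pq p∣q))
        ... | no e∤n = trans (f-off-order (q * n) (*-mono-≤ q≥1 (s≤s z≤n)) (λ e∣qn → e∤n (prime-cancel pq q∤e e∣qn)))
                             (sym (f-off-order n (s≤s z≤n) e∤n))

      -- If p ∤ e and every prime of Q not dividing e is p, then e = M / p: every prime of Q divides
      -- p e, so M ∣ p e, while e ∣ M = p (M / p) and p ∤ e give e ∣ M / p.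
      order≡cofactor : ∀ E → M ≡ p * E → ¬ (p ∣ e) → (∀ q → q ∈ Q → ¬ (q ∣ e) → q ≡ p) → e ≡ E
      order≡cofactor E M≡p*E p∤e only-p =
        ∣-antisym (prime-cancel pp p∤e (subst (e ∣_) M≡p*E e∣M))
                  (*-cancelˡ-∣ p (subst (_∣ p * e) M≡p*E (distinct-primes-∣ Q Q-prime Q-unique Q∣pe)))
        where
        instance _ = >-nonZero (<-trans (s≤s z≤n) p>1)
        Q∣pe : All (_∣ p * e) Q
        Q∣pe = All.tabulate λ {q} q∈Q → q∣pe q q∈Q
          where
          q∣pe : ∀ q → q ∈ Q → q ∣ p * e
          q∣pe q q∈Q with q ∣? e
          ... | yes q∣e = ∣n⇒∣m*n p q∣e
          ... | no q∤e = subst (_∣ p * e) (sym (only-p q q∈Q q∤e)) (m∣m*n e)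

      -- In that situation p is odd: p = 2 would force e = 1 (2 ∣ b ^ e - 1 implies 2 ∣ b - 1),
      -- hence M = 2.
      cofactor-odd : ∀ E → M ≡ p * E → e ≡ E → p ≢ 2
      cofactor-odd E M≡p*E e≡E refl = <⇒≱ M≥3 (≤-reflexive (trans M≡p*E (cong (2 *_) E≡1)))
        where
        E≡1 : E ≡ 1
        E≡1 = trans (sym e≡E) (∣1⇒≡1 (divides⇒ 1 (two∣u⇒two∣u1 b e b≥1 e≥1 (Order.p∣u o))))

      -- Otherwise p ∈ Q and e = E = M / p.  Only the divisors p E (sign +) and E (sign −) have
      -- f ≠ 0, and lifting the exponent at the odd prime p gives f (p E) = f E + 1.
      unbalanced : p ∈ Q → ¬ (p ∣ e) → (∀ q → q ∈ Q → ¬ (q ∣ e) → q ≡ p) → Σ± true f Q ≡ Σ± false f Q + 1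
      unbalanced p∈Q p∤e only-p with ∈-∃++ p∈Q
      ... | ys , zs , refl = begin
        Σ± true f (ys ++ p ∷ zs)       ≡⟨ Σ±-move true f ys p zs ⟩
        Σ± true f (p ∷ Q')             ≡⟨ proj₁ tops ⟩
        f (p * E)                      ≡⟨ f-top ⟩
        f E + 1                        ≡⟨ cong (_+ 1) (proj₂ tops) ⟨
        Σ± false f (p ∷ Q') + 1        ≡⟨ cong (_+ 1) (Σ±-move false f ys p zs) ⟨
        Σ± false f (ys ++ p ∷ zs) + 1  ∎
        where
        open ≡-Reasoning
        Q' = ys ++ zs
        E = product Q'
        Q'>1 : All (1 <_) Q'
        Q'>1 = ++⁺ (proj₁ (++⁻ ys Q>1)) (All.tail (proj₂ (++⁻ ys Q>1)))
        E≥1 = product-pos Q'>1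
        M≡p*E : M ≡ p * E
        M≡p*E = trans (product-++ ys (p ∷ zs))
                  (trans (x∙yz≈y∙xz (product ys) p (product zs)) (cong (p *_) (sym (product-++ ys zs))))
        e≡E = order≡cofactor E M≡p*E p∤e only-p
        e∤proper : ∀ d → d ∣ E → d ≢ E → ¬ (e ∣ d)
        e∤proper d d∣E d≢E e∣d = d≢E (∣-antisym d∣E (subst (_∣ d) e≡E e∣d))
        tops = Σ±-two-tops f p Q' Q'>1 λ d d∣E d≢E →
          f-off-order d (divisor-pos E≥1 d∣E) (e∤proper d d∣E d≢E) ,
          f-off-order (p * d) (*-mono-≤ (<-trans (s≤s z≤n) p>1) (divisor-pos E≥1 d∣E))
                      (λ e∣pd → e∤proper d d∣E d≢E (prime-cancel pp p∤e e∣pd))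
        f-top : f (p * E) ≡ f E + 1
        f-top = begin
          v (u b (p * E))        ≡⟨ cong v (u-^ b E p) ⟩
          v (u (b ^ E) p)        ≡⟨ cong (λ z → v (u z p)) (^≡1+u b E b≥1) ⟩
          v (u (suc (u b E)) p)  ≡⟨ lte-odd pp (cofactor-odd E M≡p*E e≡E) (u b E) (u-pos b E b≥2 E≥1)
                                            (order-∣ b≥1 o E (subst (_∣ E) (sym e≡E) ∣-refl)) ⟩
          v (u b E) + 1          ∎

      dividing-bound : Σ± true f Q ≤ v M + Σ± false f Q
      dividing-bound with Any.any? (λ q → ¬? (q ∣? e) ×-dec ¬? (q ≟ p)) Q
      ... | yes some = let q , q∈Q , q∤e , q≢p = find some in
                       ≤-trans (≤-reflexive (balanced q q∈Q q∤e q≢p)) (m≤n+m _ (v M))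
      ... | no none = ≤-trans (≤-reflexive (unbalanced p∈Q p∤e only-p))
                              (≤-trans (≤-reflexive (+-comm _ 1)) (+-monoˡ-≤ _ vM≥1))
        where
        only-p : ∀ q → q ∈ Q → ¬ (q ∣ e) → q ≡ p
        only-p q q∈Q q∤e = decidable-stable (q ≟ p) (λ q≢p → none (lose q∈Q (q∤e , q≢p)))
        q₀ = proj₁ some-q∤e
        q₀∈Q = proj₁ (proj₂ some-q∤e)
        q₀≡p = only-p q₀ q₀∈Q (proj₂ (proj₂ some-q∤e))
        p∈Q : p ∈ Q
        p∈Q = subst (_∈ Q) q₀≡p q₀∈Q
        p∤e : ¬ (p ∣ e)
        p∤e = subst (λ z → ¬ (z ∣ e)) q₀≡p (proj₂ (proj₂ some-q∤e))
        vM≥1 : 1 ≤ v M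
        vM≥1 = val-∣ p>1 M M≥1 (∈⇒∣product p∈Q)

    val-bound : Σ± true f Q ≤ v M + Σ± false f Q
    val-bound with p ∣? u b M
    ... | no p∤uM = subst (_≤ v M + Σ± false f Q) (sym (coprime-case p∤uM)) z≤n
    ... | yes p∣uM = Dividing.dividing-bound p∣uM

  X>0 = Π±-pos true (u b) Q Q≥1 u>0
  Y>0 = Π±-pos false (u b) Q Q≥1 u>0

  X∣MY : X ∣ M * Y
  X∣MY = val-criterion X (M * Y) X>0 (*-mono-≤ M≥1 Y>0) λ p pp →
    let open AtPrime p pp in begin
      v X                  ≡⟨ val-Π± pp true (u b) Q Q≥1 u>0 ⟩
      Σ± true f Q          ≤⟨ val-bound ⟩
      v M + Σ± false f Q   ≡⟨ cong (v M +_) (val-Π± pp false (u b) Q Q≥1 u>0) ⟨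
      v M + v Y            ≡⟨ val-* pp M Y M≥1 Y>0 ⟨
      v (M * Y)            ∎
    where open ≤-Reasoning

  -- Comparing b ^ d with b ^ d - 1 in X and Y turns X ∣ M Y into b ^ φ(M) ≤ 2 ^ N M,
  -- N = 2 ^ (k - 1) being the number of divisors of each sign.
  bound : b ^ totient Q ≤ 2 ^ Σ± true (λ _ → 1) Q * M
  bound = *-cancelˡ-≤ (b ^ Sid⁻) (begin
      b ^ Sid⁻ * b ^ totient Q           ≡⟨ ^-distribˡ-+-* b Sid⁻ (totient Q) ⟨
      b ^ (Sid⁻ + totient Q)             ≡⟨ cong (b ^_) (sym (Σ±-id Q Q≥1)) ⟩
      b ^ Sid⁺                           ≡⟨ Π±-^ true b (λ n → n) Q ⟨
      Π± true (b ^_) Q                   ≤⟨ Π±-mono true _ _ Q Q≥1 b^≤2u ⟩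
      Π± true (λ n → 2 ^ 1 * u b n) Q    ≡⟨ Π±-* true (λ _ → 2 ^ 1) (u b) Q ⟩
      Π± true (λ _ → 2 ^ 1) Q * X        ≡⟨ cong (_* X) (Π±-^ true 2 (λ _ → 1) Q) ⟩
      2 ^ N * X                          ≤⟨ *-monoʳ-≤ (2 ^ N) (∣⇒≤ X∣MY) ⟩
      2 ^ N * (M * Y)                    ≤⟨ *-monoʳ-≤ (2 ^ N) (*-monoʳ-≤ M (Π±-mono false _ _ Q Q≥1 u≤b^)) ⟩
      2 ^ N * (M * Π± false (b ^_) Q)    ≡⟨ cong (λ z → 2 ^ N * (M * z)) (Π±-^ false b (λ n → n) Q) ⟩
      2 ^ N * (M * b ^ Sid⁻)             ≡⟨ rearrange (2 ^ N) M (b ^ Sid⁻) ⟩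
      b ^ Sid⁻ * (2 ^ N * M)             ∎)
    where
    open ≤-Reasoning
    N = Σ± true (λ _ → 1) Q
    Sid⁺ = Σ± true (λ n → n) Q
    Sid⁻ = Σ± false (λ n → n) Q
    instance _ = >-nonZero (^-pos b Sid⁻ b≥1)
    instance _ = >-nonZero (*-mono-≤ M≥1 Y>0)
    b^≤2u : ∀ n → 1 ≤ n → b ^ n ≤ 2 ^ 1 * u b n
    b^≤2u n n≥1 = subst (_≤ 2 ^ 1 * u b n) (sym (^≡1+u b n b≥1)) (1+y≤2y (u b n) (u-pos b n b≥2 n≥1))
      where
      1+y≤2y : ∀ y → 1 ≤ y → suc y ≤ 2 ^ 1 * y
      1+y≤2y y y≥1 = subst₂ _≤_ (+-comm y 1) (cong (y +_) (sym (+-identityʳ y))) (+-monoʳ-≤ y y≥1)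
    u≤b^ : ∀ n → 1 ≤ n → u b n ≤ b ^ n
    u≤b^ n _ = m∸n≤m (b ^ n) 1
    rearrange : ∀ a m c → a * (m * c) ≡ c * (a * m)
    rearrange = solve-∀

-- The pairs (b, Q) for which b ^ φ(M) ≤ 2 ^ 2 ^ (k - 1) M is possible (M = ∏ Q, k = length Q).
data Exceptional (b : ℕ) : List ℕ → Set where
  [2]     : Exceptional b (2 ∷ [])
  [3]     : b ≡ 2 → Exceptional b (3 ∷ [])
  [3,2]   : b ≤ 4 → Exceptional b (3 ∷ 2 ∷ [])
  [5,2]   : b ≡ 2 → Exceptional b (5 ∷ 2 ∷ [])
  [5,3,2] : b ≡ 2 → Exceptional b (5 ∷ 3 ∷ 2 ∷ [])

ExceptionalCases : ℕ → List ℕ → Set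
ExceptionalCases b Q = Q ≡ 2 ∷ [] ⊎ (Q ≡ 3 ∷ [] × b ≡ 2) ⊎ (Q ≡ 3 ∷ 2 ∷ [] × b ≤ 4) ⊎
                       (Q ≡ 5 ∷ 2 ∷ [] × b ≡ 2) ⊎ (Q ≡ 5 ∷ 3 ∷ 2 ∷ [] × b ≡ 2)

cases⇒exceptional : ∀ {b Q} → ExceptionalCases b Q → Exceptional b Q
cases⇒exceptional (inj₁ refl) = [2]
cases⇒exceptional (inj₂ (inj₁ (refl , b≡2))) = [3] b≡2
cases⇒exceptional (inj₂ (inj₂ (inj₁ (refl , b≤4)))) = [3,2] b≤4
cases⇒exceptional (inj₂ (inj₂ (inj₂ (inj₁ (refl , b≡2))))) = [5,2] b≡2
cases⇒exceptional (inj₂ (inj₂ (inj₂ (inj₂ (refl , b≡2))))) = [5,3,2] b≡2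

exceptional⇒cases : ∀ {b Q} → Exceptional b Q → ExceptionalCases b Q
exceptional⇒cases [2] = inj₁ refl
exceptional⇒cases ([3] b≡2) = inj₂ (inj₁ (refl , b≡2))
exceptional⇒cases ([3,2] b≤4) = inj₂ (inj₂ (inj₁ (refl , b≤4)))
exceptional⇒cases ([5,2] b≡2) = inj₂ (inj₂ (inj₂ (inj₁ (refl , b≡2))))
exceptional⇒cases ([5,3,2] b≡2) = inj₂ (inj₂ (inj₂ (inj₂ (refl , b≡2))))

exceptional? : ∀ b Q → Dec (Exceptional b Q)
exceptional? b Q = map′ cases⇒exceptional exceptional⇒cases
  (is (2 ∷ []) ⊎-dec (is (3 ∷ []) ×-dec b ≟ 2) ⊎-dec (is (3 ∷ 2 ∷ []) ×-dec b ≤? 4) ⊎-dec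
   (is (5 ∷ 2 ∷ []) ×-dec b ≟ 2) ⊎-dec (is (5 ∷ 3 ∷ 2 ∷ []) ×-dec b ≟ 2))
  where
  is : ∀ R → Dec (Q ≡ R)
  is = ≡-dec _≟_ Q

Large : ℕ → ℕ → List ℕ → Set
Large b q Q = 2 ^ 2 ^ length Q * (q * product Q) < b ^ ((q ∸ 1) * totient Q)

¬prime[4] : ¬ Prime 4
¬prime[4] = composite⇒¬prime composite[4]

¬prime[6] : ¬ Prime 6
¬prime[6] = composite⇒¬prime composite[6]

<-base : ∀ {K b} c x → K < c ^ x → c ≤ b → K < b ^ x
<-base {K} {b} c x K<c^x c≤b = <-≤-trans K<c^x (^-monoˡ-≤ x c≤b)

2≤b≢2⇒3≤b : ∀ {b} → 2 ≤ b → b ≢ 2 → 3 ≤ b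
2≤b≢2⇒3≤b b≥2 b≢2 = ≤∧≢⇒< b≥2 (λ 2≡b → b≢2 (sym 2≡b))

8[7+r]<2^[6+r] : ∀ r → 8 * (7 + r) < 2 ^ (6 + r)
8[7+r]<2^[6+r] zero = s≤s (m≤m+n 56 7)
8[7+r]<2^[6+r] (suc r) = begin-strict
  8 * (7 + suc r)            ≡⟨ *-distribˡ-+ 8 1 (7 + r) ⟩
  8 + 8 * (7 + r)            <⟨ +-monoʳ-< 8 (8[7+r]<2^[6+r] r) ⟩
  8 + 2 ^ (6 + r)            ≤⟨ +-monoˡ-≤ (2 ^ (6 + r)) (^-monoʳ-≤ 2 {3} {6 + r} (s≤s (s≤s (s≤s z≤n)))) ⟩
  2 ^ (6 + r) + 2 ^ (6 + r)  ≡⟨ cong (2 ^ (6 + r) +_) (sym (+-identityʳ _)) ⟩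
  2 ^ (7 + r)                ∎
  where open ≤-Reasoning

-- With q = 7 + r on top of a tail contributing a factor at most 64 ^ k, the bound holds as soon as
-- the tail's totient m exceeds k.
large-last : ∀ k r m K → suc k ≤ m → K ≤ 64 ^ k * (8 * (7 + r)) → K < 2 ^ ((6 + r) * m)
large-last k r m K k<m K≤ = begin-strict
  K                       ≤⟨ K≤ ⟩
  64 ^ k * (8 * (7 + r))  ≤⟨ *-monoˡ-≤ _ (^-monoˡ-≤ k P≥64) ⟩
  P ^ k * (8 * (7 + r))   <⟨ *-monoʳ-< (P ^ k) (8[7+r]<2^[6+r] r) ⟩
  P ^ k * P               ≡⟨ *-comm (P ^ k) P ⟩
  P ^ suc k               ≡⟨ ^-*-assoc 2 (6 + r) (suc k) ⟩
  2 ^ ((6 + r) * suc k)   ≤⟨ ^-monoʳ-≤ 2 (*-monoʳ-≤ (6 + r) k<m) ⟩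
  2 ^ ((6 + r) * m)       ∎
  where
  open ≤-Reasoning
  P = 2 ^ (6 + r)
  P≥64 : 64 ≤ P
  P≥64 = ^-monoʳ-≤ 2 {6} {6 + r} (m≤m+n 6 r)
  instance _ = >-nonZero (^-pos P k (≤-trans (s≤s z≤n) P≥64))

3+s≤5^s : ∀ s → 1 ≤ s → 3 + s ≤ 5 ^ s
3+s≤5^s (suc zero) _ = s≤s (s≤s (s≤s (s≤s z≤n)))
3+s≤5^s (suc (suc s)) _ = begin
  3 + suc (suc s)                         ≤⟨ +-monoʳ-≤ 1 (3+s≤5^s (suc s) (s≤s z≤n)) ⟩
  1 + 5 ^ suc s                           ≤⟨ +-monoˡ-≤ (5 ^ suc s) (^-pos 5 (suc s) (s≤s z≤n)) ⟩
  5 ^ suc s + 5 ^ suc s                   ≤⟨ m≤m+n (5 ^ suc s + 5 ^ suc s) _ ⟩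
  5 ^ suc s + 5 ^ suc s + 3 * 5 ^ suc s   ≡⟨ five (5 ^ suc s) ⟩
  5 ^ suc (suc s)                         ∎
  where
  open ≤-Reasoning
  five : ∀ x → x + x + 3 * x ≡ 5 * x
  five = solve-∀

square-step : ∀ W M' B s → 2 ≤ W → 2 ≤ M' → W * M' < B → 1 ≤ s → W * W * ((3 + s) * M') < B ^ (2 + s)
square-step W M' B s W≥2 M'≥2 WM'<B s≥1 = begin-strict
  W * W * ((3 + s) * M')      ≡⟨ *-identityʳ _ ⟨
  W * W * ((3 + s) * M') * 1  ≤⟨ *-monoʳ-≤ (W * W * ((3 + s) * M')) (≤-trans (s≤s z≤n) M'≥2) ⟩
  W * W * ((3 + s) * M') * M' ≡⟨ regroup W M' (3 + s) ⟩
  (3 + s) * (Z * Z)           ≤⟨ *-monoˡ-≤ (Z * Z) (≤-trans (3+s≤5^s s s≥1) (^-monoˡ-≤ s B≥5)) ⟩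
  B ^ s * (Z * Z)             <⟨ *-monoʳ-< (B ^ s) (*-mono-< WM'<B WM'<B) ⟩
  B ^ s * (B * B)             ≡⟨ regroup′ B (B ^ s) ⟩
  B ^ (2 + s)                 ∎
  where
  open ≤-Reasoning
  Z = W * M'
  B≥5 : 5 ≤ B
  B≥5 = ≤-trans (s≤s (*-mono-≤ W≥2 M'≥2)) WM'<B
  instance _ = >-nonZero (^-pos B s (≤-trans (s≤s z≤n) B≥5))
  regroup : ∀ W M c → W * W * (c * M) * M ≡ c * ((W * M) * (W * M))
  regroup = solve-∀
  regroup′ : ∀ B P → P * (B * B) ≡ B * (B * P)
  regroup′ = solve-∀

extend : ∀ b q q' Q → 4 ≤ q → 2 ≤ q' * product Q → Large b q' Q → Large b q (q' ∷ Q)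
extend b q@(suc (suc (suc (suc s)))) q' Q _ M'≥2 IH = begin-strict
  2 ^ (2 ^ n + (2 ^ n + 0)) * (q * M')  ≡⟨ cong (λ z → 2 ^ (2 ^ n + z) * (q * M')) (+-identityʳ (2 ^ n)) ⟩
  2 ^ (2 ^ n + 2 ^ n) * (q * M')        ≡⟨ cong (_* (q * M')) (^-distribˡ-+-* 2 (2 ^ n) (2 ^ n)) ⟩
  W * W * ((3 + suc s) * M')            <⟨ square-step W M' (b ^ φ') (suc s) W≥2 M'≥2 IH (s≤s z≤n) ⟩
  (b ^ φ') ^ (2 + suc s)                ≡⟨ ^-*-assoc b φ' (2 + suc s) ⟩
  b ^ (φ' * (2 + suc s))                ≡⟨ cong (b ^_) (*-comm φ' (2 + suc s)) ⟩
  b ^ ((q ∸ 1) * φ')                    ∎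
  where
  open ≤-Reasoning
  n = length Q
  M' = q' * product Q
  φ' = (q' ∸ 1) * totient Q
  W = 2 ^ 2 ^ n
  W≥2 : 2 ≤ W
  W≥2 = ^-≥2 2 (2 ^ n) ≤-refl (^-pos 2 n (s≤s z≤n))
extend b 3 q' Q (s≤s (s≤s (s≤s ()))) _ _
extend b 2 q' Q (s≤s (s≤s ())) _ _
extend b 1 q' Q (s≤s ()) _ _

large-over-nothing : ∀ b q → 2 ≤ b → Prime q → ¬ Exceptional b (q ∷ []) → Large b q []
large-over-nothing b 0 _ pq _ = ⊥-elim (<⇒≱ (prime>1 pq) z≤n)
large-over-nothing b 1 _ pq _ = ⊥-elim (<⇒≱ (prime>1 pq) (s≤s z≤n))
large-over-nothing b 2 _ _ ¬exc = ⊥-elim (¬exc [2])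
large-over-nothing b 3 b≥2 _ ¬exc with b ≟ 2
... | yes b≡2 = ⊥-elim (¬exc ([3] b≡2))
... | no b≢2 = <-base 3 2 (s≤s (m≤m+n 6 2)) (2≤b≢2⇒3≤b b≥2 b≢2)
large-over-nothing b 4 _ pq _ = ⊥-elim (¬prime[4] pq)
large-over-nothing b 5 b≥2 _ _ = <-base 2 4 (s≤s (m≤m+n 10 5)) b≥2
large-over-nothing b 6 _ pq _ = ⊥-elim (¬prime[6] pq)
large-over-nothing b (suc (suc (suc (suc (suc (suc (suc r))))))) b≥2 _ _ =
  <-base 2 ((6 + r) * 1) (large-last 0 r 1 _ ≤-refl
    (≤-trans (≤-reflexive (l₁ r)) (≤-trans (*-monoˡ-≤ (7 + r) (m≤m+n 2 6)) (≤-reflexive (l₂ r))))) b≥2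
  where
  l₁ : ∀ r → 2 * ((7 + r) * 1) ≡ 2 * (7 + r)
  l₁ = solve-∀
  l₂ : ∀ r → 8 * (7 + r) ≡ 1 * (8 * (7 + r))
  l₂ = solve-∀

large-over-[2] : ∀ b q → 2 ≤ b → 2 < q → Prime q → ¬ Exceptional b (q ∷ 2 ∷ []) → Large b q (2 ∷ [])
large-over-[2] b 3 b≥2 _ _ ¬exc with b ≤? 4
... | yes b≤4 = ⊥-elim (¬exc ([3,2] b≤4))
... | no b≰4 = <-base 5 2 (s≤s (m≤m+n 24 0)) (≰⇒> b≰4)
large-over-[2] b 4 b≥2 _ pq _ = ⊥-elim (¬prime[4] pq)
large-over-[2] b 5 b≥2 _ _ ¬exc with b ≟ 2
... | yes b≡2 = ⊥-elim (¬exc ([5,2] b≡2))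
... | no b≢2 = <-base 3 4 (s≤s (m≤m+n 40 40)) (2≤b≢2⇒3≤b b≥2 b≢2)
large-over-[2] b 6 b≥2 _ pq _ = ⊥-elim (¬prime[6] pq)
large-over-[2] b (suc (suc (suc (suc (suc (suc (suc r))))))) b≥2 _ _ _ =
  <-base 2 ((6 + r) * 1) (large-last 0 r 1 _ ≤-refl (≤-reflexive (l r))) b≥2
  where
  l : ∀ r → 4 * ((7 + r) * 2) ≡ 1 * (8 * (7 + r))
  l = solve-∀
large-over-[2] b 2 b≥2 (s≤s (s≤s ())) _ _
large-over-[2] b 1 b≥2 (s≤s ()) _ _
large-over-[2] b 0 b≥2 () _ _

large-over-[3] : ∀ b q → 2 ≤ b → 3 < q → Prime q → Large b q (3 ∷ [])
large-over-[3] b 4 b≥2 _ pq = ⊥-elim (¬prime[4] pq)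
large-over-[3] b 5 b≥2 _ _ = <-base 2 8 (s≤s (m≤m+n 60 195)) b≥2
large-over-[3] b 6 b≥2 _ pq = ⊥-elim (¬prime[6] pq)
large-over-[3] b (suc (suc (suc (suc (suc (suc (suc r))))))) b≥2 _ _ =
  <-base 2 ((6 + r) * 2) (large-last 1 r 2 _ (s≤s (s≤s z≤n))
    (≤-trans (≤-reflexive (l₁ r)) (≤-trans (*-monoˡ-≤ (7 + r) (m≤m+n 12 500)) (≤-reflexive (l₂ r))))) b≥2
  where
  l₁ : ∀ r → 4 * ((7 + r) * 3) ≡ 12 * (7 + r)
  l₁ = solve-∀
  l₂ : ∀ r → 512 * (7 + r) ≡ 64 * 1 * (8 * (7 + r))
  l₂ = solve-∀
large-over-[3] b 3 b≥2 (s≤s (s≤s (s≤s ()))) _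
large-over-[3] b 2 b≥2 (s≤s (s≤s ())) _
large-over-[3] b 1 b≥2 (s≤s ()) _
large-over-[3] b 0 b≥2 () _

large-over-[3,2] : ∀ b q → 2 ≤ b → 3 < q → Prime q → ¬ Exceptional b (q ∷ 3 ∷ 2 ∷ []) → Large b q (3 ∷ 2 ∷ [])
large-over-[3,2] b 4 b≥2 _ pq _ = ⊥-elim (¬prime[4] pq)
large-over-[3,2] b 5 b≥2 _ _ ¬exc with b ≟ 2
... | yes b≡2 = ⊥-elim (¬exc ([5,3,2] b≡2))
... | no b≢2 = <-base 3 8 (s≤s (m≤m+n 480 6080)) (2≤b≢2⇒3≤b b≥2 b≢2)
large-over-[3,2] b 6 b≥2 _ pq _ = ⊥-elim (¬prime[6] pq)
large-over-[3,2] b (suc (suc (suc (suc (suc (suc (suc r))))))) b≥2 _ _ _ =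
  <-base 2 ((6 + r) * 2) (large-last 1 r 2 _ (s≤s (s≤s z≤n))
    (≤-trans (≤-reflexive (l₁ r)) (≤-trans (*-monoˡ-≤ (7 + r) (m≤m+n 96 416)) (≤-reflexive (l₂ r))))) b≥2
  where
  l₁ : ∀ r → 16 * ((7 + r) * 6) ≡ 96 * (7 + r)
  l₁ = solve-∀
  l₂ : ∀ r → 512 * (7 + r) ≡ 64 * 1 * (8 * (7 + r))
  l₂ = solve-∀
large-over-[3,2] b 3 b≥2 (s≤s (s≤s (s≤s ()))) _ _
large-over-[3,2] b 2 b≥2 (s≤s (s≤s ())) _ _
large-over-[3,2] b 1 b≥2 (s≤s ()) _ _
large-over-[3,2] b 0 b≥2 () _ _

large-over-[5,2] : ∀ b q → 2 ≤ b → 5 < q → Prime q → Large b q (5 ∷ 2 ∷ [])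
large-over-[5,2] b 6 b≥2 _ pq = ⊥-elim (¬prime[6] pq)
large-over-[5,2] b (suc (suc (suc (suc (suc (suc (suc r))))))) b≥2 _ _ =
  <-base 2 ((6 + r) * 4) (large-last 1 r 4 _ (s≤s (s≤s z≤n))
    (≤-trans (≤-reflexive (l₁ r)) (≤-trans (*-monoˡ-≤ (7 + r) (m≤m+n 160 352)) (≤-reflexive (l₂ r))))) b≥2
  where
  l₁ : ∀ r → 16 * ((7 + r) * 10) ≡ 160 * (7 + r)
  l₁ = solve-∀
  l₂ : ∀ r → 512 * (7 + r) ≡ 64 * 1 * (8 * (7 + r))
  l₂ = solve-∀
large-over-[5,2] b 5 b≥2 (s≤s (s≤s (s≤s (s≤s (s≤s ()))))) _
large-over-[5,2] b 4 b≥2 (s≤s (s≤s (s≤s (s≤s ())))) _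
large-over-[5,2] b 3 b≥2 (s≤s (s≤s (s≤s ()))) _
large-over-[5,2] b 2 b≥2 (s≤s (s≤s ())) _
large-over-[5,2] b 1 b≥2 (s≤s ()) _
large-over-[5,2] b 0 b≥2 () _

large-over-[5,3,2] : ∀ b q → 2 ≤ b → 5 < q → Prime q → Large b q (5 ∷ 3 ∷ 2 ∷ [])
large-over-[5,3,2] b 6 b≥2 _ pq = ⊥-elim (¬prime[6] pq)
large-over-[5,3,2] b (suc (suc (suc (suc (suc (suc (suc r))))))) b≥2 _ _ =
  <-base 2 ((6 + r) * 8) (large-last 2 r 8 _ (s≤s (s≤s (s≤s z≤n)))
    (≤-trans (≤-reflexive (l₁ r)) (≤-trans (*-monoˡ-≤ (7 + r) (m≤m+n 7680 25088)) (≤-reflexive (l₂ r))))) b≥2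
  where
  l₁ : ∀ r → 256 * ((7 + r) * 30) ≡ 7680 * (7 + r)
  l₁ = solve-∀
  l₂ : ∀ r → 32768 * (7 + r) ≡ 64 * (64 * 1) * (8 * (7 + r))
  l₂ = solve-∀
large-over-[5,3,2] b 5 b≥2 (s≤s (s≤s (s≤s (s≤s (s≤s ()))))) _
large-over-[5,3,2] b 4 b≥2 (s≤s (s≤s (s≤s (s≤s ())))) _
large-over-[5,3,2] b 3 b≥2 (s≤s (s≤s (s≤s ()))) _
large-over-[5,3,2] b 2 b≥2 (s≤s (s≤s ())) _
large-over-[5,3,2] b 1 b≥2 (s≤s ()) _
large-over-[5,3,2] b 0 b≥2 () _

head≥3 : ∀ q Q → AllPairs _>_ (q ∷ Q) → All Prime (q ∷ Q) → q ∷ Q ≢ 2 ∷ [] → 3 ≤ q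
head≥3 (suc (suc (suc _))) Q _ _ _ = s≤s (s≤s (s≤s z≤n))
head≥3 2 [] _ _ ≢[2] = ⊥-elim (≢[2] refl)
head≥3 2 (q' ∷ Q) ((q'<2 ∷ _) ∷ _) (_ ∷ pq' ∷ _) _ = ⊥-elim (<⇒≱ q'<2 (prime>1 pq'))
head≥3 1 Q _ (p1 ∷ _) _ = ⊥-elim (<⇒≱ (prime>1 p1) ≤-refl)
head≥3 0 Q _ (p0 ∷ _) _ = ⊥-elim (<⇒≱ (prime>1 p0) z≤n)

large : ∀ b → 2 ≤ b → ∀ q Q → AllPairs _>_ (q ∷ Q) → All Prime (q ∷ Q) → ¬ Exceptional b (q ∷ Q) → Large b q Q
large b b≥2 q [] _ (pq ∷ []) ¬exc = large-over-nothing b q b≥2 pq ¬exc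
large b b≥2 q (q' ∷ Q) ((q'<q ∷ _) ∷ dec) (pq ∷ pQ@(pq' ∷ pQ')) ¬exc with exceptional? b (q' ∷ Q)
... | no ¬exc' = extend b q q' Q q≥4 (*-mono-≤ (prime>1 pq') (productOfPrimes≥1 pQ'))
                   (large b b≥2 q' Q dec pQ ¬exc')
  where
  q≥4 : 4 ≤ q
  q≥4 = ≤-trans (s≤s (head≥3 q' Q dec pQ (λ { refl → ¬exc' [2] }))) q'<q
... | yes [2]         = large-over-[2] b q b≥2 q'<q pq ¬exc
... | yes ([3] _)     = large-over-[3] b q b≥2 q'<q pq
... | yes ([3,2] _)   = large-over-[3,2] b q b≥2 q'<q pq ¬exc
... | yes ([5,2] _)   = large-over-[5,2] b q b≥2 q'<q pq
... | yes ([5,3,2] _) = large-over-[5,3,2] b q b≥2 q'<q pq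

primitive? : ∀ b M p → Dec (Primitive b M p)
primitive? b M p = prime? p ×-dec p ∣? u b M ×-dec
  map′ (λ h k k≥1 k<M → h k<M k≥1) (λ h {k} k<M k≥1 → h k k≥1 k<M)
       (allUpTo? (λ k → 1 ≤? k →-dec ¬? (p ∣? u b k)) M)

-- A primitive divisor is at most b ^ M - 1, so its existence is decidable too.
primitive-or-not : ∀ b M → 2 ≤ b → 1 ≤ M → HasPrimitive b M ⊎ NoPrimitive b M
primitive-or-not b M b≥2 M≥1 with anyUpTo? (primitive? b M) (suc (u b M))
... | yes (p , _ , prim) = inj₁ (p , prim)
... | no none = inj₂ earlier
  where
  instance _ = >-nonZero (u-pos b M b≥2 M≥1)
  earlier : NoPrimitive b M
  earlier p pp p∣uM with anyUpTo? (λ k → 1 ≤? k ×-dec p ∣? u b k) M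
  ... | yes (k , k<M , k≥1 , p∣uk) = k , k≥1 , k<M , p∣uk
  ... | no ¬earlier = ⊥-elim (none (p , s≤s (∣⇒≤ p∣uM) , pp , p∣uM ,
                               λ k k≥1 k<M p∣uk → ¬earlier (k , k<M , k≥1 , p∣uk)))

primitive⇒order : ∀ {b N p} → 2 ≤ b → 1 ≤ N → Primitive b N p → ∀ m → p ∣ u b m → N ∣ m
primitive⇒order {b} {N} {p} b≥2 N≥1 (pp , p∣uN , earlier) m p∣um = subst (_∣ m) e≡N (divides⇒ m p∣um)
  where
  o = order b p N (≤-trans (s≤s z≤n) b≥2) N≥1 p∣uN
  open Order o
  e≡N : e ≡ N
  e≡N with m≤n⇒m<n∨m≡n (∣⇒≤ (divides⇒ N p∣uN))
    where instance _ = >-nonZero N≥1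
  ... | inj₂ e≡N = e≡N
  ... | inj₁ e<N = ⊥-elim (earlier e e≥1 e<N p∣u)

odd-divisor-of-succ : ∀ x p → 1 ≤ x → Prime p → p ≢ 2 → p ∣ x + 1 → Primitive x 2 p
odd-divisor-of-succ (suc y) p _ pp p≢2 p∣x+1 = pp , p∣u2 , earlier
  where
  x = suc y
  p∣u2 : p ∣ u x 2
  p∣u2 = subst (p ∣_) (sym (trans (u-gs y 2) (cong (y *_) (cong (_+ 1) (*-identityʳ x))))) (∣n⇒∣m*n y p∣x+1)
  earlier : ∀ k → 1 ≤ k → k < 2 → ¬ (p ∣ u x k)
  earlier 1 _ _ p∣u1 = p≢2 (prime∣prime pp prime[2] (∣m+n∣m⇒∣n (subst (p ∣_) (sym (+-suc y 1)) p∣x+1) p∣y))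
    where
    p∣y : p ∣ y
    p∣y = subst (p ∣_) (trans (u-gs y 1) (*-identityʳ y)) p∣u1
  earlier (suc (suc _)) _ (s≤s (s≤s ()))

odd-prime-factor : ∀ w → 1 ≤ w → Σ ℕ λ p → Prime p × p ∣ suc (2 * w) × p ≢ 2
odd-prime-factor w w≥1 with primeFactor (suc (2 * w)) (s≤s (*-mono-≤ (s≤s (z≤n {1})) w≥1))
... | p , pp , p∣ = p , pp , p∣ , λ { refl → 2∤ p∣ }
  where
  2∤ : ¬ (2 ∣ suc (2 * w))
  2∤ 2∣ = <⇒≱ (s≤s (s≤s z≤n)) (∣⇒≤ (∣m+n∣m⇒∣n (subst (2 ∣_) (+-comm 1 (2 * w)) 2∣) (m∣m*n w)))

half≥1 : ∀ {c} k → 2 ≤ c → c ≡ 2 * k ⊎ c ≡ suc (2 * k) → 1 ≤ k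
half≥1 (suc k) _ _ = s≤s z≤n
half≥1 zero c≥2 (inj₁ refl) = ⊥-elim (<⇒≱ c≥2 z≤n)
half≥1 zero (s≤s ()) (inj₂ refl)

-- For c ≥ 2, c ^ 2 + 1 has an odd prime factor: it is 1 + 2 (2 k²) for c = 2 k, and
-- 2 (1 + 2 (k² + k)) for c = 2 k + 1.
square+1-odd-factor : ∀ c → 2 ≤ c → Σ ℕ λ p → Prime p × p ∣ c ^ 2 + 1 × p ≢ 2
square+1-odd-factor c c≥2 = from-parity (even-or-odd c)
  where
  from-parity : (Σ ℕ λ k → c ≡ 2 * k) ⊎ (Σ ℕ λ k → c ≡ suc (2 * k)) → Σ ℕ λ p → Prime p × p ∣ c ^ 2 + 1 × p ≢ 2
  from-parity (inj₁ (k , c≡2k)) =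
    let p , pp , p∣ , p≢2 = odd-prime-factor (2 * (k * k)) (*-mono-≤ (s≤s (z≤n {1})) (*-mono-≤ k≥1 k≥1))
    in p , pp , subst (p ∣_) (sym (trans (cong (λ z → z ^ 2 + 1) c≡2k) (even² k))) p∣ , p≢2
    where
    k≥1 = half≥1 k c≥2 (inj₁ c≡2k)
    even² : ∀ k → 2 * k * (2 * k * 1) + 1 ≡ suc (2 * (2 * (k * k)))
    even² = solve-∀
  from-parity (inj₂ (k , c≡2k+1)) =
    let p , pp , p∣ , p≢2 = odd-prime-factor (k * k + k) (≤-trans k≥1 (m≤n+m k (k * k)))
    in p , pp , subst (p ∣_) (sym (trans (cong (λ z → z ^ 2 + 1) c≡2k+1) (odd² k))) (∣n⇒∣m*n 2 p∣) , p≢2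
    where
    k≥1 = half≥1 k c≥2 (inj₂ c≡2k+1)
    odd² : ∀ k → suc (2 * k) * (suc (2 * k) * 1) + 1 ≡ 2 * suc (2 * (k * k + k))
    odd² = solve-∀

square-primitive : ∀ c → 2 ≤ c → HasPrimitive (c ^ 2) 2
square-primitive c c≥2 =
  let p , pp , p∣ , p≢2 = square+1-odd-factor c c≥2
  in p , odd-divisor-of-succ (c ^ 2) p (^-pos c 2 (≤-trans (s≤s z≤n) c≥2)) pp p≢2 p∣

-- The exceptional cases of the counting bound that are not exceptions to Zsigmondy's theorem,
-- checked by computation.
primitive-2-3 : HasPrimitive 2 3
primitive-2-3 = 7 , from-yes (primitive? 2 3 7)

primitive-2-10 : HasPrimitive 2 10
primitive-2-10 = 11 , from-yes (primitive? 2 10 11)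

primitive-2-30 : HasPrimitive 2 30
primitive-2-30 = 331 , from-yes (primitive? 2 30 331)

primitive-3-6 : HasPrimitive 3 6
primitive-3-6 = 7 , from-yes (primitive? 3 6 7)

primitive-4-6 : HasPrimitive 4 6
primitive-4-6 = 13 , from-yes (primitive? 4 6 13)

-- Zsigmondy's theorem for squarefree M = ∏ Q ≥ 3 outside the exceptional cases: otherwise
-- the bound from the absence of primitive divisors contradicts the counting bound.
zsigmondy-squarefree : ∀ b Q → 2 ≤ b → AllPairs _>_ Q → All Prime Q → 3 ≤ product Q →
                       ¬ Exceptional b Q → HasPrimitive b (product Q)
zsigmondy-squarefree b [] _ _ _ (s≤s ()) _
zsigmondy-squarefree b Q@(q ∷ Q') b≥2 dec pQ M≥3 ¬exc with primitive-or-not b (product Q) b≥2 (≤-trans (s≤s z≤n) M≥3)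
... | inj₁ prim = prim
... | inj₂ none = ⊥-elim (<⇒≱ (large b b≥2 q Q' dec pQ ¬exc) too-small)
  where
  too-small : b ^ totient Q ≤ 2 ^ 2 ^ length Q' * product Q
  too-small = subst (λ n → b ^ totient Q ≤ 2 ^ n * product Q) (Σ±-count true q Q')
                (NoPrimitiveBound.bound b b≥2 Q pQ (AllPairs.map >⇒≢ dec) M≥3 none)

-- The prime divisors of N in decreasing order (their product is the radical of N).
primeDivisors : ℕ → List ℕ
primeDivisors N = filter (λ q → prime? q ×-dec q ∣? N) (downFrom (suc N))

primeDivisors-spec : ∀ N → All (λ q → Prime q × q ∣ N) (primeDivisors N)
primeDivisors-spec N = All.tabulate λ q∈ → proj₂ (∈-filter⁻ (λ q → prime? q ×-dec q ∣? N) {xs = downFrom (suc N)} q∈)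

primeDivisors-decreasing : ∀ N → AllPairs _>_ (primeDivisors N)
primeDivisors-decreasing N = AllPairsₚ.filter⁺ (λ q → prime? q ×-dec q ∣? N) (applyDownFrom⁺₁ _ (suc N) (λ j<i _ → j<i))

primeDivisors-complete : ∀ N r → 1 ≤ N → Prime r → r ∣ N → r ∈ primeDivisors N
primeDivisors-complete N r N≥1 pr r∣N =
  ∈-filter⁺ (λ q → prime? q ×-dec q ∣? N) (∈-downFrom⁺ (s≤s (∣⇒≤ r∣N))) (pr , r∣N)
  where instance _ = >-nonZero N≥1

cofactor≥2 : ∀ {N c e} → 1 ≤ N → N ≡ c * e → e < N → 2 ≤ c
cofactor≥2 {c = zero} N≥1 N≡0 _ = ⊥-elim (<⇒≱ N≥1 (≤-reflexive N≡0))
cofactor≥2 {c = 1} {e} _ N≡e e<N = ⊥-elim (<⇒≢ e<N (sym (trans N≡e (+-identityʳ e))))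
cofactor≥2 {c = 2+ _} _ _ _ = s≤s (s≤s z≤n)

-- If e is a proper divisor of N = t M and every prime factor of N divides M, then e ∣ t m
-- for a proper divisor m = M / r of M (r a prime factor of N / e).
proper-divisor-below : ∀ t M e → 1 ≤ t * M → (∀ r → Prime r → r ∣ t * M → r ∣ M) → e ∣ t * M → e < t * M →
                       Σ ℕ λ m → 1 ≤ m × m < M × e ∣ t * m
proper-divisor-below t M e N≥1 primes-in-M (divides c N≡c*e) e<N with primeFactor c (cofactor≥2 N≥1 N≡c*e e<N)
... | r , pr , divides c' c≡c'*r = m , m≥1 , m<M , divides c' t*m≡c'*e
  where
  regroup : ∀ x y z → x * y * z ≡ x * z * y
  regroup = solve-∀
  r∣M : r ∣ M
  r∣M = primes-in-M r pr (divides (c' * e) (trans N≡c*e (trans (cong (_* e) c≡c'*r) (regroup c' r e))))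
  m = quotient r∣M
  M≡m*r = m∣n⇒n≡quotient*m r∣M
  M≥1 : 1 ≤ M
  M≥1 = n≢0⇒n>0 (λ M≡0 → <⇒≱ N≥1 (≤-reflexive (trans (cong (t *_) M≡0) (*-zeroʳ t))))
  m≥1 : 1 ≤ m
  m≥1 = quotient-pos M≥1 M≡m*r
  m<M : m < M
  m<M = subst (m <_) (sym M≡m*r) (m<m*n m r (prime>1 pr))
    where instance _ = >-nonZero m≥1
  t*m≡c'*e : t * m ≡ c' * e
  t*m≡c'*e = *-cancelʳ-≡ (t * m) (c' * e) r (begin
    t * m * r     ≡⟨ *-assoc t m r ⟩
    t * (m * r)   ≡⟨ cong (t *_) M≡m*r ⟨
    t * M         ≡⟨ N≡c*e ⟩
    c * e         ≡⟨ cong (_* e) c≡c'*r ⟩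
    c' * r * e    ≡⟨ regroup c' r e ⟩
    c' * e * r    ∎)
    where
    open ≡-Reasoning
    instance _ = >-nonZero (<-trans (s≤s z≤n) (prime>1 pr))

-- A primitive divisor for a ^ t at M is one for a at N = t M when every prime of N divides M:
-- a smaller order e < N would give e ∣ t m with m < M, contradicting primitivity at M.
lift-primitive : ∀ a t M → 2 ≤ a → 1 ≤ t → 1 ≤ M → (∀ r → Prime r → r ∣ t * M → r ∣ M) →
                 HasPrimitive (a ^ t) M → HasPrimitive a (t * M)
lift-primitive a t M a≥2 t≥1 M≥1 primes-in-M (p , pp , p∣u[a^t]M , earlier) = p , pp , p∣uN , earlierN
  where
  a≥1 = ≤-trans (s≤s z≤n) a≥2
  N≥1 = *-mono-≤ t≥1 M≥1
  u-lift : ∀ m → u a (t * m) ≡ u (a ^ t) m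
  u-lift m = cong (_∸ 1) (sym (^-*-assoc a t m))
  p∣uN : p ∣ u a (t * M)
  p∣uN = subst (p ∣_) (sym (u-lift M)) p∣u[a^t]M
  o = order a p (t * M) a≥1 N≥1 p∣uN
  open Order o using (e; divides⇒)
  earlierN : ∀ j → 1 ≤ j → j < t * M → ¬ (p ∣ u a j)
  earlierN j j≥1 j<N p∣uj =
    let m , m≥1 , m<M , e∣tm = proper-divisor-below t M e N≥1 primes-in-M (divides⇒ (t * M) p∣uN) e<N
    in earlier m m≥1 m<M (subst (p ∣_) (u-lift m) (order-∣ a≥1 o (t * m) e∣tm))
    where
    e<N = ≤-<-trans (∣⇒≤ (divides⇒ j p∣uj)) j<N
      where instance _ = >-nonZero j≥1

^≡2 : ∀ a t → 2 ≤ a → 1 ≤ t → a ^ t ≡ 2 → a ≡ 2 × t ≡ 1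
^≡2 a 1 _ _ a^1≡2 = trans (sym (*-identityʳ a)) a^1≡2 , refl
^≡2 a (suc (suc t)) a≥2 _ a^t≡2 =
  ⊥-elim (<⇒≱ (≤-trans (s≤s (s≤s (s≤s z≤n))) (*-mono-≤ a≥2 (^-≥2 a (suc t) a≥2 (s≤s z≤n)))) (≤-reflexive a^t≡2))

-- The exceptional cases of the counting bound for b = a ^ t, M = ∏ Q, N = t M: either excluded
-- by M ≠ 2 and (a, N) ≠ (2, 6), or settled by the computations above.
exceptional-primitive : ∀ a t Q → 2 ≤ a → 1 ≤ t → Exceptional (a ^ t) Q → product Q ≢ 2 →
                        ¬ (a ≡ 2 × t * product Q ≡ 6) → HasPrimitive (a ^ t) (product Q)
exceptional-primitive a t _ _ _ [2] M≢2 _ = ⊥-elim (M≢2 refl)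
exceptional-primitive a t _ _ _ ([3] b≡2) _ _ = subst (λ b → HasPrimitive b 3) (sym b≡2) primitive-2-3
exceptional-primitive a t _ _ _ ([5,2] b≡2) _ _ = subst (λ b → HasPrimitive b 10) (sym b≡2) primitive-2-10
exceptional-primitive a t _ _ _ ([5,3,2] b≡2) _ _ = subst (λ b → HasPrimitive b 30) (sym b≡2) primitive-2-30
exceptional-primitive a t _ a≥2 t≥1 ([3,2] b≤4) _ not-2-6 = six (a ^ t) (^-≥2 a t a≥2 t≥1) b≤4 refl
  where
  six : ∀ b → 2 ≤ b → b ≤ 4 → b ≡ a ^ t → HasPrimitive b 6
  six 2 _ _ 2≡a^t with ^≡2 a t a≥2 t≥1 (sym 2≡a^t)
  ... | a≡2 , refl = ⊥-elim (not-2-6 (a≡2 , refl))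
  six 3 _ _ _ = primitive-3-6
  six 4 _ _ _ = primitive-4-6
  six (suc (suc (suc (suc (suc _))))) _ (s≤s (s≤s (s≤s (s≤s ())))) _
  six 1 (s≤s ()) _ _

-- If the radical of N = 2 t ≥ 3 is 2, then t is even and a ^ t is a square.
radical-two-primitive : ∀ a t → 2 ≤ a → 3 ≤ t * 2 → (∀ r → Prime r → r ∣ t * 2 → r ∣ 2) → HasPrimitive (a ^ t) 2
radical-two-primitive a t a≥2 N≥3 primes-in-2 = square-case (primeFactor t t≥2)
  where
  t≥2 : 2 ≤ t
  t≥2 = cofactor≥2 (≤-trans (s≤s z≤n) N≥3) refl (≤-trans (s≤s (s≤s (s≤s z≤n))) N≥3)
  square-case : (Σ ℕ λ r → Prime r × r ∣ t) → HasPrimitive (a ^ t) 2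
  square-case (r , pr , r∣t) with prime∣prime pr prime[2] (primes-in-2 r pr (∣m⇒∣m*n 2 r∣t))
  ... | refl = subst (λ b → HasPrimitive b 2) a^s^2≡a^t (square-primitive (a ^ s) (^-≥2 a s a≥2 s≥1))
    where
    s = quotient r∣t
    t≡s*2 = m∣n⇒n≡quotient*m r∣t
    s≥1 = quotient-pos (≤-trans (s≤s z≤n) t≥2) t≡s*2
    a^s^2≡a^t : (a ^ s) ^ 2 ≡ a ^ t
    a^s^2≡a^t = trans (^-*-assoc a s 2) (cong (a ^_) (sym t≡s*2))

primitive-at-radical : ∀ a t Q → 2 ≤ a → 1 ≤ t → AllPairs _>_ Q → All Prime Q → 2 ≤ product Q →
                       (∀ r → Prime r → r ∣ t * product Q → r ∣ product Q) → 3 ≤ t * product Q →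
                       ¬ (a ≡ 2 × t * product Q ≡ 6) → HasPrimitive (a ^ t) (product Q)
primitive-at-radical a t Q a≥2 t≥1 Q-decreasing Q-prime M≥2 primes-in-M N≥3 not-2-6 with product Q ≟ 2
... | yes M≡2 = subst (HasPrimitive (a ^ t)) (sym M≡2)
                  (radical-two-primitive a t a≥2 (subst (λ m → 3 ≤ t * m) M≡2 N≥3)
                    (subst (λ m → ∀ r → Prime r → r ∣ t * m → r ∣ m) M≡2 primes-in-M))
... | no M≢2 with exceptional? (a ^ t) Q
...   | yes exc = exceptional-primitive a t Q a≥2 t≥1 exc M≢2 not-2-6
...   | no ¬exc = zsigmondy-squarefree (a ^ t) Q (^-≥2 a t a≥2 t≥1) Q-decreasing Q-prime
                    (≤∧≢⇒< M≥2 (λ 2≡M → M≢2 (sym 2≡M))) ¬exc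

-- Zsigmondy's theorem: for a ≥ 2 and N ≥ 3 with (a, N) ≠ (2, 6), a ^ N - 1 has a primitive
-- prime divisor.  Write N = t M with M the radical of N, find one for b = a ^ t at M, and lift.
zsigmondy : ∀ a N → 2 ≤ a → 3 ≤ N → ¬ (a ≡ 2 × N ≡ 6) → HasPrimitive a N
zsigmondy a N a≥2 N≥3 not-2-6 =
  subst (HasPrimitive a) (sym N≡t*M)
    (lift-primitive a t M a≥2 t≥1 M≥1 primes-in-M
      (primitive-at-radical a t Q a≥2 t≥1 Q-decreasing Q-prime M≥2 primes-in-M
        (subst (3 ≤_) N≡t*M N≥3) (λ (a≡2 , N≡6) → not-2-6 (a≡2 , trans N≡t*M N≡6))))
  where
  N≥1 = ≤-trans (s≤s z≤n) N≥3
  Q = primeDivisors N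
  Q-prime = All.map proj₁ (primeDivisors-spec N)
  Q-decreasing = primeDivisors-decreasing N
  M = product Q
  M≥1 = productOfPrimes≥1 Q-prime
  M∣N = distinct-primes-∣ Q Q-prime (AllPairs.map >⇒≢ Q-decreasing) (All.map proj₂ (primeDivisors-spec N))
  t = quotient M∣N
  N≡t*M = m∣n⇒n≡quotient*m M∣N
  t≥1 = quotient-pos N≥1 N≡t*M
  primes-in-M : ∀ r → Prime r → r ∣ t * M → r ∣ M
  primes-in-M r pr r∣N = ∈⇒∣product (primeDivisors-complete N r N≥1 pr (subst (r ∣_) (sym N≡t*M) r∣N))
  M≥2 : 2 ≤ M
  M≥2 with primeFactor N (≤-trans (s≤s (s≤s z≤n)) N≥3)
  ... | r , pr , r∣N = ≤-trans (prime>1 pr) (∣⇒≤ (primes-in-M r pr (subst (r ∣_) N≡t*M r∣N)))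
    where instance _ = >-nonZero M≥1

prime∣product : ∀ {p} → Prime p → ∀ xs → p ∣ product xs → Σ ℕ λ x → x ∈ xs × p ∣ x
prime∣product pp [] p∣1 = ⊥-elim (<⇒≱ (prime>1 pp) (∣⇒≤ p∣1))
prime∣product pp (x ∷ xs) p∣ with euclidsLemma x (product xs) pp p∣
... | inj₁ p∣x = x , here refl , p∣x
... | inj₂ p∣xs with prime∣product pp xs p∣xs
...   | y , y∈xs , p∣y = y , there y∈xs , p∣y

-- S is the set of exponents that are not tracked (those dividing 6, or 2, or none, depending
-- on a); F ns is the sublist of tracked exponents and P ns the product of the a ^ n - 1.
module Cancellation (a : ℕ) (a≥2 : 2 ≤ a) (S : ℕ → Set) (S? : ∀ n → Dec (S n)) where

  F : List ℕ → List ℕ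
  F = filter (λ n → ¬? (S? n))

  P : List ℕ → ℕ
  P ns = product (map (u a) ns)

  Cancellable : ℕ → Set
  Cancellable N = ∀ ns ms → All (1 ≤_) ns → All (1 ≤_) ms → P ns ≡ P ms →
                  All (_≤ N) (F ns ++ F ms) → N ∈ F ns → N ∈ ms

  record Removal (N : ℕ) (ns : List ℕ) : Set where
    field
      rest      : List ℕ
      shorter   : length ns ≡ suc (length rest)
      product≡  : P ns ≡ u a N * P rest
      filtered  : F ns ↭ N ∷ F rest
      positive  : All (1 ≤_) rest

  remove : ∀ {N ns} → N ∈ ns → ¬ S N → All (1 ≤_) ns → Removal N ns
  remove {N} m ¬SN ns≥1 with ∈-∃++ m
  ... | ys , zs , refl = record
    { rest = ys ++ zs
    ; shorter = length-++-sucʳ ys N zs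
    ; product≡ = begin
        product (map (u a) (ys ++ N ∷ zs))                  ≡⟨ cong product (map-++ (u a) ys (N ∷ zs)) ⟩
        product (map (u a) ys ++ u a N ∷ map (u a) zs)      ≡⟨ product-++ (map (u a) ys) (u a N ∷ map (u a) zs) ⟩
        P ys * (u a N * P zs)                               ≡⟨ x∙yz≈y∙xz (P ys) (u a N) (P zs) ⟩
        u a N * (P ys * P zs)                               ≡⟨ cong (u a N *_) (product-++ (map (u a) ys) (map (u a) zs)) ⟨
        u a N * product (map (u a) ys ++ map (u a) zs)      ≡⟨ cong (λ l → u a N * product l) (map-++ (u a) ys zs) ⟨
        u a N * P (ys ++ zs)                                ∎
    ; filtered = ↭-trans (↭-reflexive (trans (filter-++ F? ys (N ∷ zs)) (cong (F ys ++_) (filter-accept F? ¬SN))))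
                   (↭-trans (shift N (F ys) (F zs)) (↭-reflexive (cong (N ∷_) (sym (filter-++ F? ys zs)))))
    ; positive = ++⁺ (proj₁ (++⁻ ys ns≥1)) (All.tail (proj₂ (++⁻ ys ns≥1)))
    }
    where
    open ≡-Reasoning
    F? = λ n → ¬? (S? n)

  -- Both sides agree on their largest tracked exponent N; cancel u a N and recurse.
  cancel : (∀ N → 1 ≤ N → ¬ S N → Cancellable N) → ∀ ns ms →
           All (1 ≤_) ns → All (1 ≤_) ms → P ns ≡ P ms → F ns ↭ F ms
  cancel cancellable ns ms = <-rec Motive step (length ns) ns ms refl
    where
    Motive : ℕ → Set
    Motive n = ∀ ns ms → length ns ≡ n → All (1 ≤_) ns → All (1 ≤_) ms → P ns ≡ P ms → F ns ↭ F ms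
    step : ∀ n → (∀ {n'} → n' < n → Motive n') → Motive n
    step n rec ns ms len ns≥1 ms≥1 eq with F ns ++ F ms in tracked
    ... | [] = ↭-reflexive (trans (++-conicalˡ (F ns) (F ms) tracked) (sym (++-conicalʳ (F ns) (F ms) tracked)))
    ... | x ∷ xs = shared (on-both-sides N∈tracked)
      where
      N = max x xs
      N∈tracked : N ∈ F ns ++ F ms
      N∈tracked with argmax-sel (λ n → n) x xs
      ... | inj₁ N≡x = subst (_∈ F ns ++ F ms) (sym N≡x) (subst (x ∈_) (sym tracked) (here refl))
      ... | inj₂ N∈xs = subst (N ∈_) (sym tracked) (there N∈xs)
      bounded : All (_≤ N) (F ns ++ F ms)
      bounded = subst (All (_≤ N)) (sym tracked) (⊥≤max x xs ∷ xs≤max x xs)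
      swapped : All (_≤ N) (F ms ++ F ns)
      swapped = let l , r = ++⁻ (F ns) bounded in ++⁺ r l
      on-both-sides : N ∈ F ns ++ F ms → N ∈ ns × N ∈ ms × ¬ S N
      on-both-sides N∈ with ∈-++⁻ (F ns) N∈
      ... | inj₁ N∈Fns = let N∈ns , ¬SN = ∈-filter⁻ (λ n → ¬? (S? n)) {xs = ns} N∈Fns in
          N∈ns , cancellable N (All.lookup ns≥1 N∈ns) ¬SN ns ms ns≥1 ms≥1 eq bounded N∈Fns , ¬SN
      ... | inj₂ N∈Fms = let N∈ms , ¬SN = ∈-filter⁻ (λ n → ¬? (S? n)) {xs = ms} N∈Fms in
          cancellable N (All.lookup ms≥1 N∈ms) ¬SN ms ns ms≥1 ns≥1 (sym eq) swapped N∈Fms , N∈ms , ¬SN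
      shared : N ∈ ns × N ∈ ms × ¬ S N → F ns ↭ F ms
      shared (N∈ns , N∈ms , ¬SN) =
        ↭-trans (filtered rn) (↭-trans (↭-prep N (rec shorter′ (rest rn) (rest rm) refl (positive rn) (positive rm) eq′))
                                       (↭-sym (filtered rm)))
        where
        open Removal
        rn = remove N∈ns ¬SN ns≥1
        rm = remove N∈ms ¬SN ms≥1
        instance _ = >-nonZero (u-pos a N a≥2 (All.lookup ns≥1 N∈ns))
        eq′ : P (rest rn) ≡ P (rest rm)
        eq′ = *-cancelˡ-≡ _ _ (u a N) (trans (sym (product≡ rn)) (trans eq (product≡ rm)))
        shorter′ : length (rest rn) < n
        shorter′ = subst (length (rest rn) <_) (trans (sym (shorter rn)) len) ≤-refl

  -- A primitive divisor p of a ^ N - 1 makes N cancellable, provided untracked exponents have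
  -- only untracked multiples: p divides some a ^ m - 1 on the right, so N ∣ m, m is tracked,
  -- and maximality gives m = N.
  primitive-cancellable : (∀ N m → N ∣ m → S m → S N) → ∀ N → 1 ≤ N → ¬ S N → HasPrimitive a N → Cancellable N
  primitive-cancellable closed N N≥1 ¬SN (p , prim@(pp , p∣uN , _)) ns ms ns≥1 ms≥1 eq bounded N∈Fns
    with prime∣product pp (map (u a) ms) (subst (p ∣_) eq (∣-trans p∣uN (∈⇒∣product (∈-map⁺ (u a) N∈ns))))
    where N∈ns = proj₁ (∈-filter⁻ (λ n → ¬? (S? n)) {xs = ns} N∈Fns)
  ... | y , y∈ , p∣y with ∈-map⁻ (u a) y∈
  ... | m , m∈ms , refl = subst (_∈ ms) m≡N m∈ms
    where
    m≥1 = All.lookup ms≥1 m∈ms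
    N∣m : N ∣ m
    N∣m = primitive⇒order a≥2 N≥1 prim m p∣y
    m≤N : m ≤ N
    m≤N = All.lookup (proj₂ (++⁻ (F ns) bounded)) (∈-filter⁺ (λ n → ¬? (S? n)) m∈ms (λ Sm → ¬SN (closed N m N∣m Sm)))
    m≡N : m ≡ N
    m≡N = ≤-antisym m≤N (∣⇒≤ N∣m)
      where instance _ = >-nonZero m≥1

nondivisor≥3 : ∀ d N → 1 ≤ N → ¬ (N ∣ 2 * d) → 3 ≤ N
nondivisor≥3 d 1 _ N∤ = ⊥-elim (N∤ (1∣ (2 * d)))
nondivisor≥3 d 2 _ N∤ = ⊥-elim (N∤ (m∣m*n d))
nondivisor≥3 d (suc (suc (suc _))) _ _ = s≤s (s≤s (s≤s z≤n))

odd-prime-factor? : ∀ x → 1 ≤ x → (Σ ℕ λ p → Prime p × p ∣ x × p ≢ 2) ⊎ (∀ p → Prime p → p ∣ x → p ≡ 2)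
odd-prime-factor? x x≥1 with anyUpTo? (λ p → prime? p ×-dec p ∣? x ×-dec ¬? (p ≟ 2)) (suc x)
... | yes (p , _ , pp , p∣x , p≢2) = inj₁ (p , pp , p∣x , p≢2)
... | no none = inj₂ λ p pp p∣x → decidable-stable (p ≟ 2) (λ p≢2 → none (p , s≤s (∣⇒≤ p∣x) , pp , p∣x , p≢2))
  where instance _ = >-nonZero x≥1

only-two⇒4∣ : ∀ x → 3 ≤ x → (∀ p → Prime p → p ∣ x → p ≡ 2) → 4 ∣ x
only-two⇒4∣ x x≥3 only-2 with primeFactor x (≤-trans (s≤s (s≤s z≤n)) x≥3)
... | p , pp , p∣x with only-2 p pp p∣x
... | refl with p∣x
... | divides x' x≡x'*2 with primeFactor x' x'≥2
  where
  x'≥2 : 2 ≤ x'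
  x'≥2 = cofactor≥2 {c = x'} {e = 2} (≤-trans (s≤s z≤n) x≥3) x≡x'*2 x≥3
... | r , pr , r∣x' with only-2 r pr (∣-trans r∣x' (divides 2 (trans x≡x'*2 (*-comm x' 2))))
... | refl = subst (4 ∣_) (sym x≡x'*2) (*-monoˡ-∣ 2 r∣x')

prime∣^ : ∀ {q} y c → Prime q → q ∣ y ^ c → q ∣ y
prime∣^ y zero pq q∣1 = ⊥-elim (<⇒≱ (prime>1 pq) (∣⇒≤ q∣1))
prime∣^ y (suc c) pq q∣ with euclidsLemma y (y ^ c) pq q∣
... | inj₁ q∣y = q∣y
... | inj₂ q∣y^c = prime∣^ y c pq q∣y^c

-- For a ∉ {2, 3} no exponent is discarded.
Never : ℕ → Set
Never _ = ⊥

never? : ∀ n → Dec (Never n)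
never? _ = no (λ ())

keep-all : ∀ xs → filter (λ n → ¬? (never? n)) xs ≡ xs
keep-all xs = filter-all (λ n → ¬? (never? n)) (All.tabulate (λ _ ()))

-- When a + 1 (a ≥ 4) is a power of 2, a ^ 2 - 1 = (a - 1)(a + 1) has no primitive divisor;
-- 2 is nevertheless cancellable, because a - 1 has an odd prime factor and a + 1 does not.
module PowerOfTwoNeighbour (a : ℕ) (a≥4 : 4 ≤ a) (only-2 : ∀ p → Prime p → p ∣ a + 1 → p ≡ 2) where

  A = a ∸ 1
  B = a + 1

  a≥2 : 2 ≤ a
  a≥2 = ≤-trans (s≤s (s≤s z≤n)) a≥4
  a≡1+A : a ≡ suc A
  a≡1+A = sym (m+[n∸m]≡n (≤-trans (s≤s z≤n) a≥4))
  A≥3 : 3 ≤ A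
  A≥3 = ∸-monoˡ-≤ 1 a≥4
  B≥3 : 3 ≤ B
  B≥3 = ≤-trans (≤-trans (s≤s (s≤s (s≤s z≤n))) a≥4) (m≤m+n a 1)

  u1 : u a 1 ≡ A
  u1 = cong (_∸ 1) (*-identityʳ a)

  u2 : u a 2 ≡ A * B
  u2 = trans (cong (λ z → u z 2) a≡1+A)
        (trans (u-gs A 2) (cong (A *_) (trans (cong (_+ 1) (*-identityʳ (suc A))) (cong (_+ 1) (sym a≡1+A)))))

  -- Since 4 ∣ B and B = A + 2, A is not a power of 2.
  odd-factor-of-A : Σ ℕ λ q → Prime q × q ∣ A × q ≢ 2
  odd-factor-of-A with odd-prime-factor? A (≤-trans (s≤s z≤n) A≥3)
  ... | inj₁ odd = odd
  ... | inj₂ only-2-A =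
    ⊥-elim (4∤2 (∣m+n∣m⇒∣n (subst (4 ∣_) B≡A+2 (only-two⇒4∣ B B≥3 only-2)) (only-two⇒4∣ A A≥3 only-2-A)))
    where
    B≡A+2 : B ≡ A + 2
    B≡A+2 = trans (cong (_+ 1) a≡1+A) (trans (+-comm (suc A) 1) (+-comm 2 A))
    4∤2 : ¬ (4 ∣ 2)
    4∤2 4∣2 = <⇒≱ (s≤s (s≤s (s≤s z≤n))) (∣⇒≤ 4∣2)

  count2 : List ℕ → ℕ
  count2 xs = length (filter (_≟ 2) xs)

  open Cancellation a a≥2 Never never?

  product-1-2 : ∀ xs → All (λ x → 1 ≤ x × x ≤ 2) xs → P xs ≡ A ^ length xs * B ^ count2 xs
  product-1-2 [] [] = refl
  product-1-2 (x ∷ xs) ((x≥1 , x≤2) ∷ bounds) with x ≟ 2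
  ... | yes refl = trans (cong₂ _*_ u2 (product-1-2 xs bounds)) (interchange A B (A ^ length xs) (B ^ count2 xs))
    where
    interchange : ∀ a b c d → a * b * (c * d) ≡ a * c * (b * d)
    interchange = solve-∀
  ... | no x≢2 = trans (cong₂ _*_ (trans (cong (u a) x≡1) u1) (product-1-2 xs bounds))
                  (trans (sym (*-assoc A (A ^ length xs) _))
                    (cong (λ c → A * A ^ length xs * B ^ c) (sym (cong length (filter-reject (_≟ 2) x≢2)))))
    where
    x≡1 : x ≡ 1
    x≡1 = ≤-antisym (≤-pred (≤∧≢⇒< x≤2 x≢2)) x≥1

  -- A ^ L * B ^ c = A ^ s with c ≥ 1 is impossible: for s ≤ L the left side is larger, and
  -- for s > L it gives B ^ c = A ^ (s - L), putting an odd prime of A into B.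
  no-balance : ∀ L c s → 1 ≤ c → A ^ L * B ^ c ≢ A ^ s
  no-balance L c s c≥1 eq with s ≤? L
  ... | yes s≤L = <⇒≢ (begin-strict
          A ^ s          ≤⟨ ^-monoʳ-≤ A s≤L ⟩
          A ^ L          <⟨ m<m*n (A ^ L) (B ^ c) (^-≥2 B c (≤-trans (s≤s (s≤s z≤n)) B≥3) c≥1) ⟩
          A ^ L * B ^ c  ∎) (sym eq)
    where
    open ≤-Reasoning
    instance _ = >-nonZero (^-pos A L (≤-trans (s≤s z≤n) A≥3))
    instance _ = >-nonZero (≤-trans (s≤s z≤n) A≥3)
  ... | no s≰L = q≢2 (only-2 q pq (prime∣^ B c pq (subst (q ∣_) (sym B^c≡A^d) q∣A^d)))
    where
    q = proj₁ odd-factor-of-A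
    pq = proj₁ (proj₂ odd-factor-of-A)
    q∣A = proj₁ (proj₂ (proj₂ odd-factor-of-A))
    q≢2 = proj₂ (proj₂ (proj₂ odd-factor-of-A))
    d = s ∸ L
    s≡L+d : s ≡ L + d
    s≡L+d = sym (m+[n∸m]≡n (<⇒≤ (≰⇒> s≰L)))
    instance _ = >-nonZero (^-pos A L (≤-trans (s≤s z≤n) A≥3))
    B^c≡A^d : B ^ c ≡ A ^ d
    B^c≡A^d = *-cancelˡ-≡ _ _ (A ^ L) (trans eq (trans (cong (A ^_) s≡L+d) (^-distribˡ-+-* A L d)))
    q∣A^d : q ∣ A ^ d
    q∣A^d with d | m<n⇒0<n∸m (≰⇒> s≰L)
    ... | suc d' | _ = ∣m⇒∣m*n (A ^ d') q∣A

  -- If 2 is the largest exponent, all exponents are 1 or 2, and without a 2 on the right the two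
  -- products would be A ^ L B ^ c (c ≥ 1) and A ^ s.
  two-cancellable : Cancellable 2
  two-cancellable ns ms ns≥1 ms≥1 eq bounded 2∈ns with Any.any? (2 ≟_) ms
  ... | yes 2∈ms = 2∈ms
  ... | no 2∉ms = ⊥-elim (no-balance (length ns) (count2 ns) (length ms) some-2 balance)
    where
    within : ∀ xs → All (1 ≤_) xs → All (_≤ 2) (filter (λ n → ¬? (never? n)) xs) → All (λ x → 1 ≤ x × x ≤ 2) xs
    within xs xs≥1 xs≤2 = All.zip (xs≥1 , subst (All (_≤ 2)) (keep-all xs) xs≤2)
    ns-bounds = within ns ns≥1 (proj₁ (++⁻ (F ns) bounded))
    ms-bounds = within ms ms≥1 (proj₂ (++⁻ (F ns) bounded))
    no-2s : count2 ms ≡ 0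
    no-2s = cong length (filter-none (_≟ 2) (All.tabulate λ {x} x∈ms x≡2 → 2∉ms (subst (_∈ ms) x≡2 x∈ms)))
    some-2 : 1 ≤ count2 ns
    some-2 = filter-some (_≟ 2) (Any.map sym (subst (2 ∈_) (keep-all ns) 2∈ns))
    balance : A ^ length ns * B ^ count2 ns ≡ A ^ length ms
    balance = trans (sym (product-1-2 ns ns-bounds))
                (trans eq (trans (product-1-2 ms ms-bounds) (trans (cong (λ c → A ^ length ms * B ^ c) no-2s) (*-identityʳ _))))

-- For a ≥ 3, any prime factor of a - 1 ≥ 2 is (vacuously) primitive for N = 1.
primitive-1 : ∀ a → 3 ≤ a → HasPrimitive a 1
primitive-1 a a≥3 with primeFactor (u a 1) (subst (2 ≤_) (sym (cong (_∸ 1) (*-identityʳ a))) (∸-monoˡ-≤ 1 a≥3))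
... | p , pp , p∣ = p , pp , p∣ , λ { k k≥1 (s≤s k≤0) _ → <⇒≱ k≥1 k≤0 }

theorem-2 : ∀ ns ms → All (0 <_) ns → All (0 <_) ms → prodCyc 2 ns ms → nondivisors 6 ns ↭ nondivisors 6 ms
theorem-2 = cancel λ N N≥1 N∤6 → primitive-cancellable (λ _ _ → ∣-trans) N N≥1 N∤6
  (zsigmondy 2 N ≤-refl (nondivisor≥3 3 N N≥1 N∤6) (λ (_ , N≡6) → N∤6 (subst (_∣ 6) (sym N≡6) ∣-refl)))
  where open Cancellation 2 ≤-refl (_∣ 6) (_∣? 6)

theorem-3 : ∀ ns ms → All (0 <_) ns → All (0 <_) ms → prodCyc 3 ns ms → nondivisors 2 ns ↭ nondivisors 2 ms
theorem-3 = cancel λ N N≥1 N∤2 → primitive-cancellable (λ _ _ → ∣-trans) N N≥1 N∤2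
  (zsigmondy 3 N (s≤s (s≤s z≤n)) (nondivisor≥3 1 N N≥1 N∤2) (λ ()))
  where open Cancellation 3 (s≤s (s≤s z≤n)) (_∣ 2) (_∣? 2)

theorem-≥4 : ∀ a → 4 ≤ a → ∀ ns ms → All (0 <_) ns → All (0 <_) ms → prodCyc a ns ms → ns ↭ ms
theorem-≥4 a a≥4 ns ms ns>0 ms>0 eq =
  subst₂ _↭_ (keep-all ns) (keep-all ms) (cancel cancellable ns ms ns>0 ms>0 eq)
  where
  a≥2 = ≤-trans (s≤s (s≤s z≤n)) a≥4
  a≥3 = ≤-trans (s≤s (s≤s (s≤s z≤n))) a≥4
  open Cancellation a a≥2 Never never?
  closed : ∀ N m → N ∣ m → Never m → Never N
  closed _ _ _ ()
  cancellable : ∀ N → 1 ≤ N → ¬ Never N → Cancellable N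
  cancellable 1 N≥1 ¬S = primitive-cancellable closed 1 N≥1 ¬S (primitive-1 a a≥3)
  cancellable 2 N≥1 ¬S with odd-prime-factor? (a + 1) (m≤n+m 1 a)
  ... | inj₁ (p , pp , p∣ , p≢2) =
        primitive-cancellable closed 2 N≥1 ¬S (p , odd-divisor-of-succ a p (≤-trans (s≤s z≤n) a≥4) pp p≢2 p∣)
  ... | inj₂ only-2 = PowerOfTwoNeighbour.two-cancellable a a≥4 only-2
  cancellable N@(suc (suc (suc _))) N≥1 ¬S = primitive-cancellable closed N N≥1 ¬S
    (zsigmondy a N a≥2 (s≤s (s≤s (s≤s z≤n))) (λ (a≡2 , _) → <⇒≢ a≥3 (sym a≡2)))

proposition2p3 : (a : ℕ) → 1 < a → (ns ms : List ℕ) → All (0 <_) ns → All (0 <_) ms →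
    prodCyc a ns ms →
      (a ≡ 2 → nondivisors 6 ns ↭ nondivisors 6 ms) ×
      (a ≡ 3 → nondivisors 2 ns ↭ nondivisors 2 ms) ×
      (a ≢ 2 → a ≢ 3 → ns ↭ ms)
proposition2p3 a a>1 ns ms ns>0 ms>0 eq =
  (λ { refl → theorem-2 ns ms ns>0 ms>0 eq }) ,
  (λ { refl → theorem-3 ns ms ns>0 ms>0 eq }) ,
  (λ a≢2 a≢3 → theorem-≥4 a (a≥4 a≢2 a≢3) ns ms ns>0 ms>0 eq)
  where
  a≥4 : a ≢ 2 → a ≢ 3 → 4 ≤ a
  a≥4 a≢2 a≢3 = ≤∧≢⇒< (2≤b≢2⇒3≤b a>1 a≢2) (λ 3≡a → a≢3 (sym 3≡a))
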